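{- For every integer $n \geq 5$, $\mathcal{T}(n) \leq \frac{10}{(3/2)^5} \cdot \left(\frac{3}{2}\right)^n$, and for every integer $n \geq 6$, $\mathcal{T}(n) \leq \frac{13}{(3/2)^6} \cdot \left(\frac{3}{2}\right)^n$.
   Context: A code $\mathcal{C} \subseteq \{0,1,2\}^n$ is called trifferent with length $n$ if for any three distinct elements of $\mathcal{C}$ there exists a coordinate in which they all differ. $\mathcal{T}(n)$ denotes the maximum cardinality of a trifferent code with length $n$. -}

module Defs where

open import Data.Nat using (ℕ)
open import Data.Fin using (Fin)
open import Data.Vec using (Vec; lookup)
open import Data.List using (List)
open import Data.List.Membership.Propositional using (_∈_)
open import Data.List.Relation.Unary.Unique.Propositional using (Unique)
open import Data.Product using (∃; _×_)
open import Relation.Binary.PropositionalEquality using (_≡_)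
open import Relation.Nullary using (¬_)

Word : ℕ → Set
Word n = Vec (Fin 3) n

AllDifferAt : ∀ {n} → Word n → Word n → Word n → Fin n → Set
AllDifferAt a b c i =
  ¬ (lookup a i ≡ lookup b i) × ¬ (lookup b i ≡ lookup c i) × ¬ (lookup a i ≡ lookup c i)

-- A code is a duplicate-free list of words (a finite subset of {0,1,2}^n);
-- it is trifferent if any three distinct codewords all differ in some coordinate.
Trifferent : ∀ {n} → List (Word n) → Set
Trifferent {n} C =
  Unique C ×
  (∀ a b c → a ∈ C → b ∈ C → c ∈ C →
     ¬ (a ≡ b) → ¬ (b ≡ c) → ¬ (a ≡ c) →
     ∃ λ i → AllDifferAt a b c i)

-- Let C be trifferent of length n + 1 and, for a symbol c, let D_c consist of the codewords whose
-- first symbol is not c. Their first symbols take only two values, so no three of them are separated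
-- in the first coordinate; hence, when |D_c| ≥ 3, deleting that coordinate maps D_c injectively onto
-- a trifferent code of length n. Every codeword lies in exactly two of the D_c, so 2|C| ≤ 3 T(n),
-- and T(n + k) ≤ T(n) (3/2)^k. It remains to show T(5) ≤ 10 and T(6) ≤ 13.
--
-- These follow from classifying large trifferent codes up to coordinate and symbol permutations.
-- Suppose every trifferent code of length n with at least s′ words contains a copy of one of the
-- codes in a list of representatives, and let C have length n + 1 and at least s words, where
-- 3s′ ≤ 2s + 2. The largest D_c has at least s′ words, so its tails contain a copy of some
-- representative R, and after a symmetry every r ∈ R reappears in C as 0r or 1r. An exhaustive
-- branching search over the codes with this property finds a representative of length n + 1 in each
-- of them, the witnessing symmetries being supplied as certificates. With no representatives at all,
-- the search shows that there is no trifferent code of length 5 with 11 words, nor of length 6 with 14.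

module Submission where

open import Defs
open import Data.Nat using (ℕ; _≤_; _*_; _+_; _^_)
open import Data.List using (List; length)
open import Data.Product using (_×_)

open import Data.Bool.Base using (Bool; true; false; _∧_; _∨_; not)
import Data.Bool.Properties as Bool
open import Data.Empty using (⊥; ⊥-elim)
open import Data.Fin using (Fin; zero; suc)
open import Data.Fin.Patterns using (0F; 1F; 2F; 3F; 4F; 5F)
open import Data.Fin.Permutation using (Permutation′; permutation; _⟨$⟩ʳ_; _⟨$⟩ˡ_; inverseˡ; inverseʳ; transpose; _∘ₚ_; flip)
import Data.Fin.Permutation as Perm
import Data.Fin.Properties as Fin
open import Data.List using ([]; _∷_; [_]; map; filter; concatMap; allFin; _++_)
open import Data.Bool.ListAction using (all; any)
open import Data.List.Membership.Propositional using (_∈_; _∉_; find)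
open import Data.List.Membership.Propositional.Properties using (∈-map⁺; ∈-map⁻; ∈-filter⁺; ∈-filter⁻; ∈-++⁺ˡ; ∈-++⁺ʳ; ∈-++⁻; ∈-concatMap⁺; ∈-allFin)
open import Data.List.Properties using (length-map; length-++; filter-notAll)
open import Data.List.Relation.Binary.Subset.Propositional using (_⊆_)
open import Data.List.Relation.Unary.All using (All; []; _∷_)
import Data.List.Relation.Unary.All as All
import Data.List.Relation.Unary.All.Properties as All
open import Data.List.Relation.Unary.AllPairs using ([]; _∷_)
open import Data.List.Relation.Unary.Any using (Any; here; there)
open import Data.List.Relation.Unary.Any.Properties using (¬Any[])
import Data.List.Relation.Unary.Any as Any
open import Data.List.Relation.Unary.Unique.Propositional using (Unique)
import Data.List.Relation.Unary.Unique.Propositional.Properties as Unique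
open import Data.Maybe using (Maybe; just; nothing)
open import Data.Nat using (zero; suc; z≤n; s≤s; _<_; _≤?_; _<?_; _⊔_)
open import Data.Nat.Properties
open import Algebra.Properties.CommutativeSemigroup *-commutativeSemigroup using (x∙yz≈y∙xz)
open import Data.Product using (Σ; ∃; _,_; proj₁; proj₂)
open import Data.Sum using (_⊎_; inj₁; inj₂)
import Data.Sum
open import Data.Vec using (Vec; []; _∷_; lookup; tabulate; head; tail)
open import Data.Vec.Properties using (lookup∘tabulate; tabulate∘lookup; tabulate-cong)
import Data.Vec.Properties as Vec
open import Function using (_∘_; _↔_; Inverse; Injection; mk↔ₛ′)
open import Function.Construct.Composition using (_↔-∘_)
open import Function.Construct.Symmetry using (↔-sym)
open import Function.Definitions using (Injective)
open import Function.Properties.Inverse using (↔⇒↣)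
open import Relation.Binary.Definitions using (DecidableEquality)
import Relation.Unary as U
open import Relation.Binary.PropositionalEquality using (_≡_; _≢_; refl; sym; trans; cong; cong₂; subst)
open import Relation.Nullary using (¬_; Dec; yes; no; _because_; does; proof; ¬?; _×-dec_; _⊎-dec_)
open import Relation.Nullary.Reflects using (Reflects; ofʸ; ofⁿ; ¬-reflects; _×-reflects_; _⊎-reflects_)
open import Relation.Nullary.Decidable using (from-yes)

thrice : ∀ m → m + m + m ≡ 3 * m
thrice m = trans (+-assoc m m m) (cong (λ t → m + (m + t)) (sym (+-identityʳ m)))

pigeonhole₂ : {A : Set} {u v x y z : A} → x ≢ y → y ≢ z → x ≢ z →
              x ≡ u ⊎ x ≡ v → y ≡ u ⊎ y ≡ v → z ≡ u ⊎ z ≡ v → ⊥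
pigeonhole₂ x≢y _   _   (inj₁ refl) (inj₁ refl) _           = x≢y refl
pigeonhole₂ x≢y _   _   (inj₂ refl) (inj₂ refl) _           = x≢y refl
pigeonhole₂ _   _   x≢z (inj₁ refl) _           (inj₁ refl) = x≢z refl
pigeonhole₂ _   _   x≢z (inj₂ refl) _           (inj₂ refl) = x≢z refl
pigeonhole₂ _   y≢z _   _           (inj₁ refl) (inj₁ refl) = y≢z refl
pigeonhole₂ _   y≢z _   _           (inj₂ refl) (inj₂ refl) = y≢z refl

largest-of-three : (x : Fin 3 → ℕ) → ∃ λ c → x 0F + x 1F + x 2F ≤ 3 * x c
largest-of-three x = c , subst (λ t → x 0F + x 1F + x 2F ≤ 3 * t) m≡xc sum≤3m
  where
  m = x 0F ⊔ x 1F ⊔ x 2F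
  sum≤3m : x 0F + x 1F + x 2F ≤ 3 * m
  sum≤3m = begin
    x 0F + x 1F + x 2F
      ≤⟨ +-mono-≤ (+-mono-≤ x₀≤m x₁≤m) x₂≤m ⟩
    m + m + m
      ≡⟨ thrice m ⟩
    3 * m ∎
    where
    open ≤-Reasoning
    x₀≤m = ≤-trans (m≤m⊔n (x 0F) (x 1F)) (m≤m⊔n (x 0F ⊔ x 1F) (x 2F))
    x₁≤m = ≤-trans (m≤n⊔m (x 0F) (x 1F)) (m≤m⊔n (x 0F ⊔ x 1F) (x 2F))
    x₂≤m = m≤n⊔m (x 0F ⊔ x 1F) (x 2F)
  argmax : ∃ λ c → m ≡ x c
  argmax with ⊔-sel (x 0F ⊔ x 1F) (x 2F) | ⊔-sel (x 0F) (x 1F)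
  ... | inj₂ m≡x₂ | _          = 2F , m≡x₂
  ... | inj₁ m≡m₀₁ | inj₁ m₀₁≡x₀ = 0F , trans m≡m₀₁ m₀₁≡x₀
  ... | inj₁ m≡m₀₁ | inj₂ m₀₁≡x₁ = 1F , trans m≡m₀₁ m₀₁≡x₁
  c = proj₁ argmax
  m≡xc = proj₂ argmax

module _ {A : Set} (_≟_ : DecidableEquality A) where

  Unique-length-≤ : ∀ {xs ys : List A} → Unique xs → xs ⊆ ys → length xs ≤ length ys
  Unique-length-≤ {[]}     _            _     = z≤n
  Unique-length-≤ {x ∷ xs} {ys} (x∉xs ∷ u) xs⊆ys = begin-strict
    length xs                          ≤⟨ Unique-length-≤ u xs⊆ys∖x ⟩
    length (filter (¬? ∘ (x ≟_)) ys)   <⟨ filter-notAll (¬? ∘ (x ≟_)) ys (Any.map (λ x≡y x≢y → x≢y x≡y) x∈ys) ⟩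
    length ys                          ∎
    where
    open ≤-Reasoning
    x∈ys = xs⊆ys (here refl)
    xs⊆ys∖x : xs ⊆ filter (¬? ∘ (x ≟_)) ys
    xs⊆ys∖x y∈xs = ∈-filter⁺ (¬? ∘ (x ≟_)) (xs⊆ys (there y∈xs)) (All.lookup x∉xs y∈xs)

  third-element : ∀ {xs} → Unique xs → 3 ≤ length xs → ∀ u v → ∃ λ z → z ∈ xs × z ≢ u × z ≢ v
  third-element {[]}          _ ()
  third-element {_ ∷ []}      _ (s≤s ())
  third-element {_ ∷ _ ∷ []}  _ (s≤s (s≤s ()))
  third-element {a ∷ b ∷ c ∷ _} ((a≢b ∷ a≢c ∷ _) ∷ (b≢c ∷ _) ∷ _) _ u v
    with a ≟ u ⊎-dec a ≟ v | b ≟ u ⊎-dec b ≟ v | c ≟ u ⊎-dec c ≟ v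
  ... | no a∉ | _     | _     = a , here refl , a∉ ∘ inj₁ , a∉ ∘ inj₂
  ... | yes _ | no b∉ | _     = b , there (here refl) , b∉ ∘ inj₁ , b∉ ∘ inj₂
  ... | yes _ | yes _ | no c∉ = c , there (there (here refl)) , c∉ ∘ inj₁ , c∉ ∘ inj₂
  ... | yes a∈ | yes b∈ | yes c∈ = ⊥-elim (pigeonhole₂ a≢b b≢c a≢c a∈ b∈ c∈)

Unique-map⁺ : {A B : Set} {f : A → B} {xs : List A} →
              (∀ {x y} → x ∈ xs → y ∈ xs → f x ≡ f y → x ≡ y) → Unique xs → Unique (map f xs)
Unique-map⁺ {xs = []}     _   []          = []
Unique-map⁺ {xs = x ∷ xs} inj (x∉xs ∷ u) =
  All.map⁺ (All.tabulate λ y∈xs fx≡fy → All.lookup x∉xs y∈xs (inj (here refl) (there y∈xs) fx≡fy))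
  ∷ Unique-map⁺ (λ x∈ y∈ → inj (there x∈) (there y∈)) u

module _ {A : Set} {P : A → Set} {p : A → Bool} (reflects : ∀ x → Reflects (P x) (p x)) where

  all-reflects : ∀ xs → Reflects (All P xs) (all p xs)
  all-reflects []       = ofʸ []
  all-reflects (x ∷ xs) with p x | reflects x
  ... | false | ofⁿ ¬px = ofⁿ λ { (px ∷ _) → ¬px px }
  ... | true  | ofʸ px with all p xs | all-reflects xs
  ...   | true  | ofʸ pxs  = ofʸ (px ∷ pxs)
  ...   | false | ofⁿ ¬pxs = ofⁿ λ { (_ ∷ pxs) → ¬pxs pxs }

  any-reflects : ∀ xs → Reflects (Any P xs) (any p xs)
  any-reflects []       = ofⁿ λ ()
  any-reflects (x ∷ xs) with p x | reflects x
  ... | true  | ofʸ px = ofʸ (here px)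
  ... | false | ofⁿ ¬px with any p xs | any-reflects xs
  ...   | true  | ofʸ pxs  = ofʸ (there pxs)
  ...   | false | ofⁿ ¬pxs = ofⁿ λ { (here px) → ¬px px ; (there pxs) → ¬pxs pxs }

Triffer : ∀ {n} → Word n → Word n → Word n → Set
Triffer a b c = ∃ (AllDifferAt a b c)

-- The search below is evaluated by the type checker, so its inner tests are Boolean table look-ups
-- with separate Reflects proofs: composites of the library's Dec combinators evaluate several times
-- more slowly.

_==_ : Fin 3 → Fin 3 → Bool
0F == 0F = true
1F == 1F = true
2F == 2F = true
_  == _  = false

distinct : Fin 3 → Fin 3 → Fin 3 → Bool
distinct 0F 1F 2F = true
distinct 0F 2F 1F = true
distinct 1F 0F 2F = true
distinct 1F 2F 0F = true
distinct 2F 0F 1F = true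
distinct 2F 1F 0F = true
distinct _  _  _  = false

==-reflects : ∀ x y → Reflects (x ≡ y) (x == y)
==-reflects x y = subst (Reflects (x ≡ y)) (agrees x y) (proof (x Fin.≟ y))
  where
  agrees : ∀ x y → does (x Fin.≟ y) ≡ (x == y)
  agrees = from-yes (Fin.all? λ x → Fin.all? λ y → does (x Fin.≟ y) Bool.≟ (x == y))

distinct-reflects : ∀ x y z → Reflects (x ≢ y × y ≢ z × x ≢ z) (distinct x y z)
distinct-reflects x y z = subst (Reflects _) (agrees x y z) (proof (distinct? x y z))
  where
  distinct? : ∀ x y z → Dec (x ≢ y × y ≢ z × x ≢ z)
  distinct? x y z = ¬? (x Fin.≟ y) ×-dec ¬? (y Fin.≟ z) ×-dec ¬? (x Fin.≟ z)
  agrees : ∀ x y z → does (distinct? x y z) ≡ distinct x y z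
  agrees = from-yes (Fin.all? λ x → Fin.all? λ y → Fin.all? λ z → does (distinct? x y z) Bool.≟ distinct x y z)

_==ʷ_ : ∀ {n} → Word n → Word n → Bool
[]       ==ʷ []       = true
(x ∷ xs) ==ʷ (y ∷ ys) = x == y ∧ xs ==ʷ ys

==ʷ-reflects : ∀ {n} (x y : Word n) → Reflects (x ≡ y) (x ==ʷ y)
==ʷ-reflects []       []       = ofʸ refl
==ʷ-reflects (x ∷ xs) (y ∷ ys) with x == y | ==-reflects x y
... | false | ofⁿ x≢y = ofⁿ (x≢y ∘ Vec.∷-injectiveˡ)
... | true  | ofʸ refl with xs ==ʷ ys | ==ʷ-reflects xs ys
...   | false | ofⁿ xs≢ys = ofⁿ (xs≢ys ∘ Vec.∷-injectiveʳ)
...   | true  | ofʸ refl  = ofʸ refl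

_≟ʷ_ : ∀ {n} → DecidableEquality (Word n)
x ≟ʷ y = (x ==ʷ y) because ==ʷ-reflects x y

_∈ᵇ_ : ∀ {n} → Word n → List (Word n) → Bool
x ∈ᵇ xs = any (x ==ʷ_) xs

∈-reflects : ∀ {n} (x : Word n) xs → Reflects (x ∈ xs) (x ∈ᵇ xs)
∈-reflects x = any-reflects (==ʷ-reflects x)

_∈?_ : ∀ {n} (x : Word n) xs → Dec (x ∈ xs)
x ∈? xs = (x ∈ᵇ xs) because ∈-reflects x xs

triffers : ∀ {n} → Word n → Word n → Word n → Bool
triffers []      []      []      = false
triffers (x ∷ a) (y ∷ b) (z ∷ c) = distinct x y z ∨ triffers a b c

triffers-reflects : ∀ {n} (a b c : Word n) → Reflects (Triffer a b c) (triffers a b c)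
triffers-reflects []      []      []      = ofⁿ λ { (() , _) }
triffers-reflects (x ∷ a) (y ∷ b) (z ∷ c) with distinct x y z | distinct-reflects x y z
... | true  | ofʸ differ = ofʸ (0F , differ)
... | false | ofⁿ same with triffers a b c | triffers-reflects a b c
...   | true  | ofʸ (j , differ) = ofʸ (suc j , differ)
...   | false | ofⁿ never        = ofⁿ λ { (zero , differ) → same differ ; (suc j , differ) → never (j , differ) }

words : (n : ℕ) → List (Word n)
words zero    = [ [] ]
words (suc n) = concatMap (λ w → map (_∷ w) (allFin 3)) (words n)

∈-words : ∀ {n} (w : Word n) → w ∈ words n
∈-words []      = here refl
∈-words (a ∷ w) = ∈-concatMap⁺ _ (Any.map (λ { refl → ∈-map⁺ (_∷ w) (∈-allFin a) }) (∈-words w))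

AllDifferAt-transport : ∀ {m n} (f : Word m → Word n) (i : Fin m) (j : Fin n) {g : Fin 3 → Fin 3} →
                        Injective _≡_ _≡_ g → (∀ x → lookup (f x) j ≡ g (lookup x i)) →
                        ∀ a b c → AllDifferAt a b c i → AllDifferAt (f a) (f b) (f c) j
AllDifferAt-transport f i j g-inj f≡g a b c (a≢b , b≢c , a≢c) = moved a≢b , moved b≢c , moved a≢c
  where
  moved : ∀ {x y} → lookup x i ≢ lookup y i → lookup (f x) j ≢ lookup (f y) j
  moved {x} {y} x≢y fx≡fy = x≢y (g-inj (trans (sym (f≡g x)) (trans fx≡fy (f≡g y))))

tails-triffer : ∀ {n} {a b c : Word (suc n)} → ¬ AllDifferAt a b c 0F → Triffer a b c → Triffer (tail a) (tail b) (tail c)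
tails-triffer {a = _ ∷ _} {_ ∷ _} {_ ∷ _} ¬head (zero  , differ) = ⊥-elim (¬head differ)
tails-triffer {a = _ ∷ _} {_ ∷ _} {_ ∷ _} _     (suc j , differ) = j , differ

perm-injective : ∀ {n} (π : Permutation′ n) → Injective _≡_ _≡_ (π ⟨$⟩ʳ_)
perm-injective π = Injection.injective (↔⇒↣ π)

-- pabc sends 0, 1, 2 to a, b, c.
p012 p102 p210 p021 p120 p201 : Permutation′ 3
p012 = Perm.id
p102 = transpose 0F 1F
p210 = transpose 0F 2F
p021 = transpose 1F 2F
p120 = p021 ∘ₚ p102
p201 = p102 ∘ₚ p021

toTwo : Fin 3 → Permutation′ 3
toTwo 0F = p210
toTwo 1F = p021
toTwo 2F = p012

toTwo-≢ : ∀ c {x} → x ≢ c → toTwo c ⟨$⟩ʳ x ≡ 0F ⊎ toTwo c ⟨$⟩ʳ x ≡ 1F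
toTwo-≢ 0F {0F} x≢c = ⊥-elim (x≢c refl)
toTwo-≢ 0F {1F} _   = inj₂ refl
toTwo-≢ 0F {2F} _   = inj₁ refl
toTwo-≢ 1F {0F} _   = inj₁ refl
toTwo-≢ 1F {1F} x≢c = ⊥-elim (x≢c refl)
toTwo-≢ 1F {2F} _   = inj₂ refl
toTwo-≢ 2F {0F} _   = inj₁ refl
toTwo-≢ 2F {1F} _   = inj₂ refl
toTwo-≢ 2F {2F} x≢c = ⊥-elim (x≢c refl)

no-three-distinct-avoiding : ∀ c {x y z : Fin 3} → x ≢ c → y ≢ c → z ≢ c → x ≢ y → y ≢ z → x ≢ z → ⊥
no-three-distinct-avoiding c x≢c y≢c z≢c x≢y y≢z x≢z =
  pigeonhole₂ (x≢y ∘ inj) (y≢z ∘ inj) (x≢z ∘ inj) (toTwo-≢ c x≢c) (toTwo-≢ c y≢c) (toTwo-≢ c z≢c)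
  where inj = perm-injective (toTwo c)

-- Deleting the first coordinate

avoiding : ∀ {n} → Fin 3 → List (Word (suc n)) → List (Word (suc n))
avoiding c = filter (λ w → ¬? (head w Fin.≟ c))

∈-avoiding⁻ : ∀ {n} c {C : List (Word (suc n))} {w} → w ∈ avoiding c C → w ∈ C × head w ≢ c
∈-avoiding⁻ c = ∈-filter⁻ (λ w → ¬? (head w Fin.≟ c))

Σ-length-avoiding : ∀ {n} (C : List (Word (suc n))) →
                    length (avoiding 0F C) + length (avoiding 1F C) + length (avoiding 2F C) ≡ 2 * length C
Σ-length-avoiding [] = refl
Σ-length-avoiding ((a ∷ v) ∷ C) = trans (two-more a) (trans (cong (2 +_) (Σ-length-avoiding C)) (sym (*-suc 2 (length C))))
  where
  x = length (avoiding 0F C)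
  y = length (avoiding 1F C)
  z = length (avoiding 2F C)
  two-more : ∀ a → let C′ = (a ∷ v) ∷ C in
             length (avoiding 0F C′) + length (avoiding 1F C′) + length (avoiding 2F C′) ≡ 2 + (x + y + z)
  two-more 0F = trans (+-suc (x + suc y) z) (cong (λ t → suc (t + z)) (+-suc x y))
  two-more 1F = +-suc (suc x + y) z
  two-more 2F = cong (λ t → suc t + z) (+-suc x y)

module _ {n} (c : Fin 3) {C : List (Word (suc n))} (tC : Trifferent C) where

  private
    D = avoiding c C

    ∈D⁻ : ∀ {w} → w ∈ D → w ∈ C × head w ≢ c
    ∈D⁻ = ∈-avoiding⁻ c

    not-separated-at-head : ∀ {x y z} → x ∈ D → y ∈ D → z ∈ D → ¬ AllDifferAt x y z 0F
    not-separated-at-head {_ ∷ _} {_ ∷ _} {_ ∷ _} x∈D y∈D z∈D (x≢y , y≢z , x≢z) =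
      no-three-distinct-avoiding c (proj₂ (∈D⁻ x∈D)) (proj₂ (∈D⁻ y∈D)) (proj₂ (∈D⁻ z∈D)) x≢y y≢z x≢z

    tails-separated : ∀ {x y z} → x ∈ D → y ∈ D → z ∈ D → x ≢ y → y ≢ z → x ≢ z → Triffer (tail x) (tail y) (tail z)
    tails-separated {x} {y} {z} x∈D y∈D z∈D x≢y y≢z x≢z =
      tails-triffer {a = x} {y} {z} (not-separated-at-head x∈D y∈D z∈D)
      (proj₂ tC _ _ _ (proj₁ (∈D⁻ x∈D)) (proj₁ (∈D⁻ y∈D)) (proj₁ (∈D⁻ z∈D)) x≢y y≢z x≢z)

  tails-trifferent : 3 ≤ length D → Trifferent (map tail D)
  tails-trifferent 3≤|D| = Unique-map⁺ tail-injective (Unique-filter (proj₁ tC)) , separated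
    where
    Unique-filter : Unique C → Unique D
    Unique-filter = Unique.filter⁺ _
    tail-injective : ∀ {x y} → x ∈ D → y ∈ D → tail x ≡ tail y → x ≡ y
    tail-injective {x} {y} x∈D y∈D tx≡ty with x ≟ʷ y
    ... | yes x≡y = x≡y
    ... | no x≢y with third-element _≟ʷ_ (Unique-filter (proj₁ tC)) 3≤|D| x y
    ...   | z , z∈D , z≢x , z≢y with tails-separated x∈D y∈D z∈D x≢y (z≢y ∘ sym) (z≢x ∘ sym)
    ...     | _ , tx≢ty , _ = ⊥-elim (tx≢ty (cong (λ t → lookup t _) tx≡ty))
    separated : ∀ a b c → a ∈ map tail D → b ∈ map tail D → c ∈ map tail D → a ≢ b → b ≢ c → a ≢ c → Triffer a b c
    separated _ _ _ a∈ b∈ c∈ a≢b b≢c a≢c with ∈-map⁻ tail a∈ | ∈-map⁻ tail b∈ | ∈-map⁻ tail c∈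
    ... | x , x∈D , refl | y , y∈D , refl | z , z∈D , refl =
      tails-separated x∈D y∈D z∈D (a≢b ∘ cong tail) (b≢c ∘ cong tail) (a≢c ∘ cong tail)

-- The growth bound

CodesBounded : ℕ → ℕ → ℕ → Set
CodesBounded n X Y = ∀ (C : List (Word n)) → Trifferent C → length C * X ≤ Y

growth-step : ∀ {n X Y} → 2 * X ≤ Y → CodesBounded n X Y → CodesBounded (suc n) (2 * X) (3 * Y)
growth-step {n} {X} {Y} 2X≤Y bounded C tC = begin
  length C * (2 * X)                    ≡⟨ trans (x∙yz≈y∙xz (length C) 2 X) (sym (*-assoc 2 (length C) X)) ⟩
  2 * length C * X                      ≡⟨ cong (_* X) (sym (Σ-length-avoiding C)) ⟩
  (|D| 0F + |D| 1F + |D| 2F) * X        ≡⟨ trans (*-distribʳ-+ X (|D| 0F + |D| 1F) (|D| 2F))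
                                                 (cong (_+ |D| 2F * X) (*-distribʳ-+ X (|D| 0F) (|D| 1F))) ⟩
  |D| 0F * X + |D| 1F * X + |D| 2F * X  ≤⟨ +-mono-≤ (+-mono-≤ (part 0F) (part 1F)) (part 2F) ⟩
  Y + Y + Y                             ≡⟨ thrice Y ⟩
  3 * Y                                 ∎
  where
  open ≤-Reasoning
  |D| : Fin 3 → ℕ
  |D| c = length (avoiding c C)
  part : ∀ c → |D| c * X ≤ Y
  part c with 3 ≤? |D| c
  ... | yes 3≤|D| = subst (λ t → t * X ≤ Y) (length-map tail (avoiding c C)) (bounded _ (tails-trifferent c tC 3≤|D|))
  ... | no  3≰|D| = ≤-trans (*-monoˡ-≤ X (≤-pred (≰⇒> 3≰|D|))) 2X≤Y

growth : ∀ {m B} → 2 ≤ B → CodesBounded m 1 B → ∀ k → CodesBounded (k + m) (2 ^ k) (B * 3 ^ k)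
growth {B = B} _ bounded zero C tC = subst (_ ≤_) (sym (*-identityʳ B)) (bounded C tC)
growth {B = B} 2≤B bounded (suc k) = subst (CodesBounded _ _) (x∙yz≈y∙xz 3 B (3 ^ k))
  (growth-step (*-mono-≤ 2≤B (^-monoˡ-≤ k (n≤1+n 2))) (growth 2≤B bounded k))

-- Symmetries of the triffering relation

PreservesTriffer : ∀ {n} → (Word n → Word n) → Set
PreservesTriffer f = ∀ a b c → Triffer a b c → Triffer (f a) (f b) (f c)

record Symmetry (n : ℕ) : Set where
  field
    bijection : Word n ↔ Word n
  open Inverse bijection public using (to; from; strictlyInverseˡ; strictlyInverseʳ)
  field
    to-triffer   : PreservesTriffer to
    from-triffer : PreservesTriffer from

open Symmetry

inverse : ∀ {n} → Symmetry n → Symmetry n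
inverse σ = record { bijection = ↔-sym (bijection σ) ; to-triffer = from-triffer σ ; from-triffer = to-triffer σ }

_∘ˢ_ : ∀ {n} → Symmetry n → Symmetry n → Symmetry n
σ ∘ˢ τ = record
  { bijection    = bijection σ ↔-∘ bijection τ
  ; to-triffer   = λ a b c → to-triffer σ (to τ a) (to τ b) (to τ c) ∘ to-triffer τ a b c
  ; from-triffer = λ a b c → from-triffer τ (from σ a) (from σ b) (from σ c) ∘ from-triffer σ a b c
  }

Trifferent-map : ∀ {n} (σ : Symmetry n) {C} → Trifferent C → Trifferent (map (to σ) C)
Trifferent-map σ {C} (unique , separated) = Unique-map⁺ (λ _ _ → injective) unique , separated′
  where
  injective : ∀ {x y} → to σ x ≡ to σ y → x ≡ y
  injective {x} {y} e = trans (sym (strictlyInverseʳ σ x)) (trans (cong (from σ) e) (strictlyInverseʳ σ y))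
  separated′ : ∀ a b c → a ∈ map (to σ) C → b ∈ map (to σ) C → c ∈ map (to σ) C → a ≢ b → b ≢ c → a ≢ c → Triffer a b c
  separated′ _ _ _ a∈ b∈ c∈ a≢b b≢c a≢c with ∈-map⁻ (to σ) a∈ | ∈-map⁻ (to σ) b∈ | ∈-map⁻ (to σ) c∈
  ... | x , x∈C , refl | y , y∈C , refl | z , z∈C , refl =
    to-triffer σ x y z (separated x y z x∈C y∈C z∈C (a≢b ∘ cong (to σ)) (b≢c ∘ cong (to σ)) (a≢c ∘ cong (to σ)))

extend : ∀ {n} → Permutation′ 3 → Symmetry n → Symmetry (suc n)
extend π σ = record
  { bijection    = mk↔ₛ′ (cons π (to σ)) (cons (flip π) (from σ)) to∘from from∘to
  ; to-triffer   = cons-triffer π (to-triffer σ)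
  ; from-triffer = cons-triffer (flip π) (from-triffer σ)
  }
  where
  cons : Permutation′ 3 → (Word _ → Word _) → Word (suc _) → Word (suc _)
  cons ρ f (a ∷ w) = (ρ ⟨$⟩ʳ a) ∷ f w
  cons-triffer : ∀ ρ {f} → PreservesTriffer f → PreservesTriffer (cons ρ f)
  cons-triffer ρ {f} f-triffer a b c (zero , differ) =
    0F , AllDifferAt-transport (cons ρ f) 0F 0F (perm-injective ρ) (λ { (_ ∷ _) → refl }) a b c differ
  cons-triffer ρ f-triffer (_ ∷ a) (_ ∷ b) (_ ∷ c) (suc j , differ) with f-triffer a b c (j , differ)
  ... | i , differ′ = suc i , differ′
  to∘from : ∀ w → cons π (to σ) (cons (flip π) (from σ) w) ≡ w
  to∘from (a ∷ w) = cong₂ _∷_ (inverseʳ π) (strictlyInverseˡ σ w)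
  from∘to : ∀ w → cons (flip π) (from σ) (cons π (to σ) w) ≡ w
  from∘to (a ∷ w) = cong₂ _∷_ (inverseˡ π) (strictlyInverseʳ σ w)

relabel : ∀ {n} → (Fin n → Fin n) → Vec (Permutation′ 3) n → Word n → Word n
relabel p σ x = tabulate λ i → lookup σ i ⟨$⟩ʳ lookup x (p i)

isometry : ∀ {n} → Permutation′ n → Vec (Permutation′ 3) n → Symmetry n
isometry {n} π σ = record
  { bijection    = mk↔ₛ′ (relabel (π ⟨$⟩ʳ_) σ) from′ to∘from from∘to
  ; to-triffer   = λ { a b c (j , differ) → π ⟨$⟩ˡ j ,
      AllDifferAt-transport to′ j (π ⟨$⟩ˡ j) (perm-injective (lookup σ (π ⟨$⟩ˡ j))) lookup-to-π⁻¹ a b c differ }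
  ; from-triffer = λ { a b c (i , differ) → π ⟨$⟩ʳ i ,
      AllDifferAt-transport from′ i (π ⟨$⟩ʳ i) (perm-injective (flip (lookup σ i))) lookup-from-π a b c differ }
  }
  where
  to′ : Word n → Word n
  to′ = relabel (π ⟨$⟩ʳ_) σ
  from′ : Word n → Word n
  from′ y = tabulate λ j → lookup σ (π ⟨$⟩ˡ j) ⟨$⟩ˡ lookup y (π ⟨$⟩ˡ j)
  lookup-to-π⁻¹ : ∀ {j} x → lookup (to′ x) (π ⟨$⟩ˡ j) ≡ lookup σ (π ⟨$⟩ˡ j) ⟨$⟩ʳ lookup x j
  lookup-to-π⁻¹ {j} x = trans (lookup∘tabulate _ (π ⟨$⟩ˡ j)) (cong (λ i → lookup σ (π ⟨$⟩ˡ j) ⟨$⟩ʳ lookup x i) (inverseʳ π))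
  lookup-from-π : ∀ {i} y → lookup (from′ y) (π ⟨$⟩ʳ i) ≡ lookup σ i ⟨$⟩ˡ lookup y i
  lookup-from-π {i} y = trans (lookup∘tabulate _ (π ⟨$⟩ʳ i)) (cong (λ k → lookup σ k ⟨$⟩ˡ lookup y k) (inverseˡ π))
  to∘from : ∀ y → to′ (from′ y) ≡ y
  to∘from y = trans (tabulate-cong λ i → trans (cong (lookup σ i ⟨$⟩ʳ_) (lookup-from-π y)) (inverseʳ (lookup σ i)))
                    (tabulate∘lookup y)
  from∘to : ∀ x → from′ (to′ x) ≡ x
  from∘to x = trans (tabulate-cong λ j → trans (cong (lookup σ (π ⟨$⟩ˡ j) ⟨$⟩ˡ_) (lookup-to-π⁻¹ x)) (inverseˡ (lookup σ (π ⟨$⟩ˡ j))))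
                    (tabulate∘lookup x)

record Certificate (n : ℕ) : Set where
  constructor cert
  field
    coordinates coordinates⁻¹ : Vec (Fin n) n
    symbols                   : Vec (Permutation′ 3) n

module _ {n} (d : Certificate n) where
  open Certificate d

  Valid : Set
  Valid = (∀ i → lookup coordinates (lookup coordinates⁻¹ i) ≡ i) × (∀ i → lookup coordinates⁻¹ (lookup coordinates i) ≡ i)

  valid? : Dec Valid
  valid? = Fin.all? (λ i → lookup coordinates (lookup coordinates⁻¹ i) Fin.≟ i)
    ×-dec Fin.all? (λ i → lookup coordinates⁻¹ (lookup coordinates i) Fin.≟ i)

  act : Word n → Word n
  act = relabel (lookup coordinates) symbols

  certified : Valid → Symmetry n
  certified (inv₁ , inv₂) = isometry (permutation (lookup coordinates) (lookup coordinates⁻¹) inv₁ inv₂) symbols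

-- Classification up to symmetry

_↪_ : ∀ {n} → List (Word n) → List (Word n) → Set
R ↪ K = Σ (Symmetry _) λ σ → ∀ {r} → r ∈ R → to σ r ∈ K

↪-map⁻ : ∀ {n} (σ : Symmetry n) {R C} → R ↪ map (to σ) C → R ↪ C
↪-map⁻ σ {C = C} (τ , τR⊆σC) = inverse σ ∘ˢ τ , λ r∈R → from-∈ (∈-map⁻ (to σ) (τR⊆σC r∈R))
  where
  from-∈ : ∀ {y} → (∃ λ x → x ∈ C × y ≡ to σ x) → from σ y ∈ C
  from-∈ (x , x∈C , refl) = subst (_∈ C) (sym (strictlyInverseʳ σ x)) x∈C

Classified : (n s : ℕ) → List (List (Word n)) → Set
Classified n s Reps = ∀ (C : List (Word n)) → Trifferent C → s ≤ length C → Any (_↪ C) Reps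

Covers : ∀ {n} → List (Word (suc n)) → List (Word n) → Set
Covers K R = ∀ {r} → r ∈ R → (0F ∷ r) ∈ K ⊎ (1F ∷ r) ∈ K

ExtensionsClassified : ∀ {n} → ℕ → List (List (Word (suc n))) → List (Word n) → Set
ExtensionsClassified s Reps R = ∀ K → Trifferent K → s ≤ length K → Covers K R → Any (_↪ K) Reps

largest-avoiding : ∀ {n} (C : List (Word (suc n))) → ∃ λ c → 2 * length C ≤ 3 * length (avoiding c C)
largest-avoiding C with c , sum≤ ← largest-of-three (λ c → length (avoiding c C)) =
  c , subst (_≤ 3 * length (avoiding c C)) (Σ-length-avoiding C) sum≤

≤-from-thirds : ∀ {L d s s′} → 2 * L ≤ 3 * d → s ≤ L → 3 * s′ ≤ 2 * s + 2 → s′ ≤ d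
≤-from-thirds {L} {d} {s} {s′} 2L≤3d s≤L 3s′≤ = ≤-pred (*-cancelˡ-< 3 s′ (suc d) (begin-strict
  3 * s′      ≤⟨ 3s′≤ ⟩
  2 * s + 2   ≤⟨ +-monoˡ-≤ 2 (≤-trans (*-monoʳ-≤ 2 s≤L) 2L≤3d) ⟩
  3 * d + 2   <⟨ +-monoʳ-< (3 * d) (n<1+n 2) ⟩
  3 * d + 3   ≡⟨ trans (+-comm (3 * d) 3) (sym (*-suc 3 d)) ⟩
  3 * suc d   ∎))
  where open ≤-Reasoning

extend-covers : ∀ {n} c {C : List (Word (suc n))} (σ : Symmetry n) {R} →
                (∀ {r} → r ∈ R → to σ r ∈ map tail (avoiding c C)) →
                Covers (map (to (extend (toTwo c) (inverse σ))) C) R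
extend-covers c {C} σ σR⊆ {r} r∈R with ∈-map⁻ tail (σR⊆ r∈R)
... | a ∷ w , w∈D , σr≡w with ∈-avoiding⁻ c {C} w∈D
...   | a∷w∈C , a≢c = Data.Sum.map placed placed (toTwo-≢ c a≢c)
  where
  τ = extend (toTwo c) (inverse σ)
  placed : ∀ {b} → toTwo c ⟨$⟩ʳ a ≡ b → (b ∷ r) ∈ map (to τ) C
  placed refl = subst (λ v → ((toTwo c ⟨$⟩ʳ a) ∷ v) ∈ map (to τ) C)
    (trans (cong (from σ) (sym σr≡w)) (strictlyInverseʳ σ r)) (∈-map⁺ (to τ) a∷w∈C)

classified-suc : ∀ {n s s′} {Reps′ : List (List (Word n))} {Reps : List (List (Word (suc n)))} →
                 3 ≤ s′ → 3 * s′ ≤ 2 * s + 2 → Classified n s′ Reps′ →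
                 (∀ {R} → R ∈ Reps′ → ExtensionsClassified s Reps R) → Classified (suc n) s Reps
classified-suc {s = s} {s′} 3≤s′ s′-small classified extensions C tC s≤|C|
  with c , 2|C|≤3|D| ← largest-avoiding C
  with s′≤|D| ← ≤-from-thirds 2|C|≤3|D| s≤|C| s′-small
  with R , R∈Reps′ , σ , σR⊆ ← find (classified (map tail (avoiding c C)) (tails-trifferent c tC (≤-trans 3≤s′ s′≤|D|))
                                                (subst (s′ ≤_) (sym (length-map tail (avoiding c C))) s′≤|D|))
  = let τ = extend (toTwo c) (inverse σ) in
    Any.map (↪-map⁻ τ) (extensions R∈Reps′ (map (to τ) C) (Trifferent-map τ tC)
                                    (subst (s ≤_) (sym (length-map (to τ) C)) s≤|C|) (extend-covers c σ σR⊆))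

bounded-if-none-large : ∀ {n B} → Classified n (suc B) [] → CodesBounded n 1 B
bounded-if-none-large {B = B} none C tC = subst (_≤ B) (sym (*-identityʳ (length C))) (≮⇒≥ λ B<|C| → ¬Any[] (none C tC B<|C|))

-- Verified search

module Search {n : ℕ} (s : ℕ) (Reps : List (List (Word n))) where

  Clause : Set
  Clause = Word n × Word n

  Unresolved : List (Word n) → Clause → Set
  Unresolved P (u , v) = ¬ (u ∈ P ⊎ v ∈ P)

  unresolved? : ∀ P → U.Decidable (Unresolved P)
  unresolved? P (u , v) = not (u ∈ᵇ P ∨ v ∈ᵇ P) because ¬-reflects (∈-reflects u P ⊎-reflects ∈-reflects v P)

  Compatible : List (Word n) → Word n → Word n → Set
  Compatible P w x = x ≢ w × All (λ p → p ≡ w ⊎ Triffer p w x) P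

  compatible? : ∀ P w → U.Decidable (Compatible P w)
  compatible? P w x = (not (x ==ʷ w) ∧ all (λ p → p ==ʷ w ∨ triffers p w x) P)
    because (¬-reflects (==ʷ-reflects x w) ×-reflects all-reflects (λ p → ==ʷ-reflects p w ⊎-reflects triffers-reflects p w x) P)

  Certifies : Certificate n → List (Word n) → List (Word n) → Set
  Certifies d P R = All (λ r → act d r ∈ P) R × Valid d

  certifies? : ∀ d P → U.Decidable (Certifies d P)
  certifies? d P R = (all (λ r → act d r ∈ᵇ P) R because all-reflects (λ r → ∈-reflects (act d r) P) R) ×-dec valid? d

  certified-↪ : ∀ {d P R K} → Certifies d P R → P ⊆ K → R ↪ K
  certified-↪ {d} (images , valid) P⊆K = certified d valid , λ r∈R → P⊆K (All.lookup images r∈R)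

  checkCertificate : List (Word n) → List (Certificate n) → Maybe (List (Certificate n))
  checkCertificate P []       = nothing
  checkCertificate P (d ∷ ds) with Any.any? (certifies? d P) Reps
  ... | true  because _ = just ds
  ... | false because _ = nothing

  search : ℕ → List (Word n) → List (Word n) → List Clause → List (Certificate n) → Maybe (List (Certificate n))
  branch : ℕ → List (Word n) → List (Word n) → List Clause → List (Certificate n) → Maybe (List (Certificate n))
  split  : ℕ → List (Word n) → List (Word n) → List Clause → List (Certificate n) → Word n → Maybe (List (Certificate n))

  search zero       P R cls ds = nothing
  search (suc fuel) P R cls ds with s ≤? length P
  ... | true  because _ = checkCertificate P ds
  ... | false because _ with length P + length R <? s
  ...   | true  because _ = just ds
  ...   | false because _ = branch fuel P R (filter (unresolved? P) cls) ds

  branch fuel P R ((u , v) ∷ cls) ds with u ∈? R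
  ... | true  because _ = split fuel P R ((u , v) ∷ cls) ds u
  ... | false because _ with v ∈? R
  ...   | true  because _ = split fuel P R ((u , v) ∷ cls) ds v
  ...   | false because _ = just ds
  branch fuel P []      [] ds = nothing
  branch fuel P (w ∷ R) [] ds = split fuel P (w ∷ R) [] ds w

  split fuel P R cls ds w with search fuel (w ∷ P) (filter (compatible? P w) R) cls ds
  ... | nothing  = nothing
  ... | just ds′ = search fuel P (filter (¬? ∘ (_≟ʷ w)) R) cls ds′

  record Invariant (K P R : List (Word n)) (cls : List Clause) : Set where
    field
      trifferent : Trifferent K
      large      : s ≤ length K
      P⊆K        : P ⊆ K
      K⊆P++R     : K ⊆ P ++ R
      hit        : ∀ {u v} → (u , v) ∈ cls → u ∈ K ⊎ v ∈ K
  open Invariant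

  checkCertificate-sound : ∀ {P ds ds′ K} → checkCertificate P ds ≡ just ds′ → P ⊆ K → Any (_↪ K) Reps
  checkCertificate-sound {P} {d ∷ ds} eq P⊆K with Any.any? (certifies? d P) Reps
  ... | yes found = Any.map (λ {R} certifies → certified-↪ {d} {P} {R} certifies P⊆K) found
  checkCertificate-sound {P} {d ∷ ds} () P⊆K | no _

  too-small : ∀ {K P R cls} → Invariant K P R cls → ¬ (length P + length R < s)
  too-small {K} {P} {R} inv P+R<s = <⇒≱ P+R<s (begin
    s                     ≤⟨ large inv ⟩
    length K              ≤⟨ Unique-length-≤ _≟ʷ_ (proj₁ (trifferent inv)) (K⊆P++R inv) ⟩
    length (P ++ R)       ≡⟨ length-++ P ⟩
    length P + length R   ∎)
    where open ≤-Reasoning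

  drop-resolved : ∀ {K P R cls} → Invariant K P R cls → Invariant K P R (filter (unresolved? P) cls)
  drop-resolved {P = P} inv = record
    { trifferent = trifferent inv ; large = large inv ; P⊆K = P⊆K inv ; K⊆P++R = K⊆P++R inv
    ; hit = hit inv ∘ proj₁ ∘ ∈-filter⁻ (unresolved? P)
    }

  include : ∀ {K P R cls w} → w ∈ K → Invariant K P R cls → Invariant K (w ∷ P) (filter (compatible? P w) R) cls
  include {K} {P} {R} {w = w} w∈K inv = record
    { trifferent = trifferent inv ; large = large inv ; hit = hit inv
    ; P⊆K        = λ { (here refl) → w∈K ; (there x∈P) → P⊆K inv x∈P }
    ; K⊆P++R     = K⊆
    }
    where
    K⊆ : K ⊆ w ∷ (P ++ filter (compatible? P w) R)
    K⊆ {x} x∈K with x ≟ʷ w | x ∈? P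
    ... | yes refl | _       = here refl
    ... | no _     | yes x∈P = there (∈-++⁺ˡ x∈P)
    ... | no x≢w   | no x∉P with ∈-++⁻ P (K⊆P++R inv x∈K)
    ...   | inj₁ x∈P = ⊥-elim (x∉P x∈P)
    ...   | inj₂ x∈R = there (∈-++⁺ʳ P (∈-filter⁺ (compatible? P w) x∈R (x≢w , All.tabulate separated)))
      where
      separated : ∀ {p} → p ∈ P → p ≡ w ⊎ Triffer p w x
      separated {p} p∈P with p ≟ʷ w
      ... | yes p≡w = inj₁ p≡w
      ... | no p≢w  = inj₂ (proj₂ (trifferent inv) p w x (P⊆K inv p∈P) w∈K x∈K p≢w (x≢w ∘ sym) λ { refl → x∉P p∈P })

  exclude : ∀ {K P R cls w} → w ∉ K → Invariant K P R cls → Invariant K P (filter (¬? ∘ (_≟ʷ w)) R) cls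
  exclude {K} {P} {R} {w = w} w∉K inv = record
    { trifferent = trifferent inv ; large = large inv ; P⊆K = P⊆K inv ; hit = hit inv
    ; K⊆P++R     = K⊆
    }
    where
    K⊆ : K ⊆ P ++ filter (¬? ∘ (_≟ʷ w)) R
    K⊆ {x} x∈K with ∈-++⁻ P (K⊆P++R inv x∈K)
    ... | inj₁ x∈P = ∈-++⁺ˡ x∈P
    ... | inj₂ x∈R = ∈-++⁺ʳ P (∈-filter⁺ (¬? ∘ (_≟ʷ w)) x∈R λ { refl → w∉K x∈K })

  search-sound : ∀ fuel {P R cls ds ds′ K} → search fuel P R cls ds ≡ just ds′ → Invariant K P R cls → Any (_↪ K) Reps
  branch-sound : ∀ fuel {P R cls ds ds′ K} → branch fuel P R cls ds ≡ just ds′ → Invariant K P R cls →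
                 All (Unresolved P) cls → Any (_↪ K) Reps
  split-sound  : ∀ fuel {P R cls ds ds′ K} w → split fuel P R cls ds w ≡ just ds′ → Invariant K P R cls → Any (_↪ K) Reps

  search-sound (suc fuel) {P} {R} {cls} {ds} eq inv with s ≤? length P
  ... | true  because _ = checkCertificate-sound {ds = ds} eq (P⊆K inv)
  ... | false because _ with length P + length R <? s
  ...   | yes P+R<s = ⊥-elim (too-small inv P+R<s)
  ...   | no _      = branch-sound fuel eq (drop-resolved inv)
                          (All.tabulate λ c∈ → proj₂ (∈-filter⁻ (unresolved? P) {xs = cls} c∈))

  branch-sound fuel {P} {R} {(u , v) ∷ cls} eq inv (unresolved ∷ _) with u ∈? R
  ... | yes _ = split-sound fuel u eq inv
  ... | no u∉R with v ∈? R
  ...   | yes _  = split-sound fuel v eq inv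
  ...   | no v∉R = ⊥-elim (Data.Sum.[ missing inj₁ u∉R , missing inj₂ v∉R ] (hit inv (here refl)))
    where
    missing : ∀ {x} → (x ∈ P → u ∈ P ⊎ v ∈ P) → x ∉ R → x ∉ _
    missing into-P x∉R x∈K = Data.Sum.[ unresolved ∘ into-P , x∉R ] (∈-++⁻ P (K⊆P++R inv x∈K))
  branch-sound fuel {P} {w ∷ R} {[]} eq inv _ = split-sound fuel w eq inv

  split-sound fuel {P} {R} {cls} {ds} {K = K} w eq inv with search fuel (w ∷ P) (filter (compatible? P w) R) cls ds in eq₁
  ... | just ds″ with w ∈? K
  ...   | yes w∈K = search-sound fuel eq₁ (include w∈K inv)
  ...   | no  w∉K = search-sound fuel eq (exclude w∉K inv)
  split-sound fuel w () inv | nothing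

module _ {n} (s : ℕ) (Reps : List (List (Word (suc n)))) where
  open Search s Reps

  clauses : List (Word n) → List Clause
  clauses = map λ r → 0F ∷ r , 1F ∷ r

  -- Every split removes the branching word from R, so the search never runs out of this fuel.
  fuel : ℕ
  fuel = suc (length (words (suc n)))

  classifyExtensions : List (List (Word n)) → List (Certificate (suc n)) → Maybe (List (Certificate (suc n)))
  classifyExtensions []       ds = just ds
  classifyExtensions (R ∷ Rs) ds with search fuel [] (words (suc n)) (clauses R) ds
  ... | nothing  = nothing
  ... | just ds′ = classifyExtensions Rs ds′

  classifyExtensions-sound : ∀ Rs {ds ds′} → classifyExtensions Rs ds ≡ just ds′ → ∀ {R} → R ∈ Rs → ExtensionsClassified s Reps R
  classifyExtensions-sound (R ∷ Rs) {ds} eq R∈ with search fuel [] (words (suc n)) (clauses R) ds in eq₁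
  ... | just ds″ with R∈
  ...   | there R∈Rs = classifyExtensions-sound Rs eq R∈Rs
  ...   | here refl  = λ K tK s≤|K| covers → search-sound fuel eq₁ record
    { trifferent = tK
    ; large      = s≤|K|
    ; P⊆K        = λ ()
    ; K⊆P++R     = λ {x} _ → ∈-words x
    ; hit        = λ uv∈ → hit-covered covers (∈-map⁻ _ uv∈)
    }
    where
    hit-covered : ∀ {K u v} → Covers K R → (∃ λ r → r ∈ R × (u , v) ≡ (0F ∷ r , 1F ∷ r)) → u ∈ K ⊎ v ∈ K
    hit-covered covers (r , r∈R , refl) = covers r∈R
  classifyExtensions-sound (R ∷ Rs) () R∈ | nothing

-- Representatives and certificates (produced by an external search)

reps-1-3 : List (List (Word 1))
reps-1-3 = ((0F ∷ []) ∷ (1F ∷ []) ∷ (2F ∷ []) ∷ []) ∷ []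

certs-1-3 : List (Certificate 1)
certs-1-3 = cert (0F ∷ []) (0F ∷ []) (p012 ∷ []) ∷ []

reps-2-4 : List (List (Word 2))
reps-2-4 =
  ((2F ∷ 2F ∷ []) ∷ (1F ∷ 2F ∷ []) ∷ (0F ∷ 1F ∷ []) ∷ (0F ∷ 0F ∷ []) ∷ [])
  ∷ []

certs-2-4 : List (Certificate 2)
certs-2-4 =
  cert (0F ∷ 1F ∷ []) (0F ∷ 1F ∷ []) (p012 ∷ p012 ∷ [])
  ∷ cert (0F ∷ 1F ∷ []) (0F ∷ 1F ∷ []) (p012 ∷ p021 ∷ [])
  ∷ cert (0F ∷ 1F ∷ []) (0F ∷ 1F ∷ []) (p102 ∷ p210 ∷ [])
  ∷ cert (0F ∷ 1F ∷ []) (0F ∷ 1F ∷ []) (p012 ∷ p210 ∷ [])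
  ∷ cert (0F ∷ 1F ∷ []) (0F ∷ 1F ∷ []) (p102 ∷ p021 ∷ [])
  ∷ cert (0F ∷ 1F ∷ []) (0F ∷ 1F ∷ []) (p102 ∷ p012 ∷ [])
  ∷ []

reps-3-5 : List (List (Word 3))
reps-3-5 =
  ((2F ∷ 0F ∷ 0F ∷ []) ∷ (1F ∷ 0F ∷ 0F ∷ []) ∷ (0F ∷ 0F ∷ 1F ∷ []) ∷ (0F ∷ 1F ∷ 2F ∷ []) ∷ (0F ∷ 2F ∷ 2F ∷ []) ∷ [])
  ∷ ((2F ∷ 2F ∷ 0F ∷ []) ∷ (1F ∷ 0F ∷ 0F ∷ []) ∷ (0F ∷ 0F ∷ 1F ∷ []) ∷ (1F ∷ 1F ∷ 2F ∷ []) ∷ (0F ∷ 2F ∷ 2F ∷ []) ∷ [])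
  ∷ []

certs-3-5 : List (Certificate 3)
certs-3-5 =
  cert (0F ∷ 1F ∷ 2F ∷ []) (0F ∷ 1F ∷ 2F ∷ []) (p012 ∷ p012 ∷ p012 ∷ [])
  ∷ cert (0F ∷ 1F ∷ 2F ∷ []) (0F ∷ 1F ∷ 2F ∷ []) (p012 ∷ p012 ∷ p102 ∷ [])
  ∷ cert (2F ∷ 0F ∷ 1F ∷ []) (1F ∷ 2F ∷ 0F ∷ []) (p021 ∷ p021 ∷ p210 ∷ [])
  ∷ cert (0F ∷ 2F ∷ 1F ∷ []) (0F ∷ 2F ∷ 1F ∷ []) (p012 ∷ p120 ∷ p210 ∷ [])
  ∷ cert (0F ∷ 1F ∷ 2F ∷ []) (0F ∷ 1F ∷ 2F ∷ []) (p012 ∷ p012 ∷ p012 ∷ [])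
  ∷ cert (0F ∷ 1F ∷ 2F ∷ []) (0F ∷ 1F ∷ 2F ∷ []) (p102 ∷ p021 ∷ p102 ∷ [])
  ∷ cert (0F ∷ 1F ∷ 2F ∷ []) (0F ∷ 1F ∷ 2F ∷ []) (p102 ∷ p021 ∷ p012 ∷ [])
  ∷ cert (0F ∷ 1F ∷ 2F ∷ []) (0F ∷ 1F ∷ 2F ∷ []) (p012 ∷ p012 ∷ p102 ∷ [])
  ∷ cert (0F ∷ 2F ∷ 1F ∷ []) (0F ∷ 2F ∷ 1F ∷ []) (p102 ∷ p210 ∷ p210 ∷ [])
  ∷ cert (0F ∷ 2F ∷ 1F ∷ []) (0F ∷ 2F ∷ 1F ∷ []) (p012 ∷ p210 ∷ p210 ∷ [])
  ∷ cert (0F ∷ 1F ∷ 2F ∷ []) (0F ∷ 1F ∷ 2F ∷ []) (p012 ∷ p021 ∷ p012 ∷ [])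
  ∷ cert (0F ∷ 1F ∷ 2F ∷ []) (0F ∷ 1F ∷ 2F ∷ []) (p102 ∷ p012 ∷ p102 ∷ [])
  ∷ cert (0F ∷ 1F ∷ 2F ∷ []) (0F ∷ 1F ∷ 2F ∷ []) (p102 ∷ p012 ∷ p012 ∷ [])
  ∷ cert (0F ∷ 1F ∷ 2F ∷ []) (0F ∷ 1F ∷ 2F ∷ []) (p012 ∷ p021 ∷ p102 ∷ [])
  ∷ cert (0F ∷ 2F ∷ 1F ∷ []) (0F ∷ 2F ∷ 1F ∷ []) (p102 ∷ p120 ∷ p210 ∷ [])
  ∷ cert (2F ∷ 0F ∷ 1F ∷ []) (1F ∷ 2F ∷ 0F ∷ []) (p120 ∷ p021 ∷ p210 ∷ [])
  ∷ cert (0F ∷ 1F ∷ 2F ∷ []) (0F ∷ 1F ∷ 2F ∷ []) (p102 ∷ p012 ∷ p102 ∷ [])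
  ∷ cert (0F ∷ 1F ∷ 2F ∷ []) (0F ∷ 1F ∷ 2F ∷ []) (p102 ∷ p012 ∷ p012 ∷ [])
  ∷ []

reps-3-6 : List (List (Word 3))
reps-3-6 =
  ((2F ∷ 1F ∷ 1F ∷ []) ∷ (2F ∷ 2F ∷ 0F ∷ []) ∷ (1F ∷ 0F ∷ 0F ∷ []) ∷ (0F ∷ 0F ∷ 1F ∷ []) ∷ (1F ∷ 1F ∷ 2F ∷ []) ∷ (0F ∷ 2F ∷ 2F ∷ []) ∷ [])
  ∷ []

certs-3-6 : List (Certificate 3)
certs-3-6 =
  cert (0F ∷ 1F ∷ 2F ∷ []) (0F ∷ 1F ∷ 2F ∷ []) (p012 ∷ p012 ∷ p012 ∷ [])
  ∷ cert (0F ∷ 1F ∷ 2F ∷ []) (0F ∷ 1F ∷ 2F ∷ []) (p102 ∷ p021 ∷ p012 ∷ [])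
  ∷ cert (0F ∷ 1F ∷ 2F ∷ []) (0F ∷ 1F ∷ 2F ∷ []) (p012 ∷ p021 ∷ p012 ∷ [])
  ∷ cert (0F ∷ 1F ∷ 2F ∷ []) (0F ∷ 1F ∷ 2F ∷ []) (p102 ∷ p012 ∷ p012 ∷ [])
  ∷ []

reps-4-7 : List (List (Word 4))
reps-4-7 =
  ((2F ∷ 0F ∷ 1F ∷ 1F ∷ []) ∷ (2F ∷ 0F ∷ 2F ∷ 0F ∷ []) ∷ (1F ∷ 0F ∷ 2F ∷ 2F ∷ []) ∷ (0F ∷ 0F ∷ 1F ∷ 2F ∷ []) ∷ (1F ∷ 0F ∷ 0F ∷ 1F ∷ []) ∷ (0F ∷ 1F ∷ 0F ∷ 0F ∷ []) ∷ (0F ∷ 2F ∷ 0F ∷ 0F ∷ []) ∷ [])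
  ∷ ((2F ∷ 1F ∷ 2F ∷ 1F ∷ []) ∷ (2F ∷ 1F ∷ 1F ∷ 0F ∷ []) ∷ (1F ∷ 0F ∷ 2F ∷ 2F ∷ []) ∷ (0F ∷ 0F ∷ 1F ∷ 2F ∷ []) ∷ (0F ∷ 0F ∷ 0F ∷ 1F ∷ []) ∷ (1F ∷ 1F ∷ 0F ∷ 0F ∷ []) ∷ (0F ∷ 2F ∷ 0F ∷ 0F ∷ []) ∷ [])
  ∷ ((1F ∷ 2F ∷ 1F ∷ 1F ∷ []) ∷ (2F ∷ 0F ∷ 1F ∷ 0F ∷ []) ∷ (1F ∷ 0F ∷ 2F ∷ 2F ∷ []) ∷ (0F ∷ 1F ∷ 1F ∷ 2F ∷ []) ∷ (0F ∷ 0F ∷ 0F ∷ 1F ∷ []) ∷ (1F ∷ 1F ∷ 0F ∷ 0F ∷ []) ∷ (0F ∷ 2F ∷ 2F ∷ 0F ∷ []) ∷ [])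
  ∷ []

certs-4-7 : List (Certificate 4)
certs-4-7 =
  cert (0F ∷ 1F ∷ 2F ∷ 3F ∷ []) (0F ∷ 1F ∷ 2F ∷ 3F ∷ []) (p012 ∷ p012 ∷ p012 ∷ p012 ∷ [])
  ∷ cert (0F ∷ 1F ∷ 2F ∷ 3F ∷ []) (0F ∷ 1F ∷ 2F ∷ 3F ∷ []) (p012 ∷ p012 ∷ p021 ∷ p012 ∷ [])
  ∷ cert (0F ∷ 1F ∷ 2F ∷ 3F ∷ []) (0F ∷ 1F ∷ 2F ∷ 3F ∷ []) (p012 ∷ p012 ∷ p012 ∷ p012 ∷ [])
  ∷ cert (2F ∷ 0F ∷ 3F ∷ 1F ∷ []) (1F ∷ 3F ∷ 0F ∷ 2F ∷ []) (p012 ∷ p021 ∷ p012 ∷ p201 ∷ [])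
  ∷ cert (0F ∷ 2F ∷ 1F ∷ 3F ∷ []) (0F ∷ 2F ∷ 1F ∷ 3F ∷ []) (p012 ∷ p021 ∷ p021 ∷ p210 ∷ [])
  ∷ cert (0F ∷ 1F ∷ 2F ∷ 3F ∷ []) (0F ∷ 1F ∷ 2F ∷ 3F ∷ []) (p012 ∷ p012 ∷ p021 ∷ p012 ∷ [])
  ∷ cert (2F ∷ 0F ∷ 3F ∷ 1F ∷ []) (1F ∷ 3F ∷ 0F ∷ 2F ∷ []) (p012 ∷ p021 ∷ p021 ∷ p201 ∷ [])
  ∷ cert (0F ∷ 2F ∷ 1F ∷ 3F ∷ []) (0F ∷ 2F ∷ 1F ∷ 3F ∷ []) (p012 ∷ p021 ∷ p012 ∷ p210 ∷ [])
  ∷ cert (0F ∷ 2F ∷ 1F ∷ 3F ∷ []) (0F ∷ 2F ∷ 1F ∷ 3F ∷ []) (p102 ∷ p012 ∷ p012 ∷ p210 ∷ [])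
  ∷ cert (0F ∷ 2F ∷ 1F ∷ 3F ∷ []) (0F ∷ 2F ∷ 1F ∷ 3F ∷ []) (p012 ∷ p021 ∷ p012 ∷ p210 ∷ [])
  ∷ cert (0F ∷ 1F ∷ 2F ∷ 3F ∷ []) (0F ∷ 1F ∷ 2F ∷ 3F ∷ []) (p102 ∷ p021 ∷ p021 ∷ p012 ∷ [])
  ∷ cert (2F ∷ 0F ∷ 3F ∷ 1F ∷ []) (1F ∷ 3F ∷ 0F ∷ 2F ∷ []) (p102 ∷ p012 ∷ p021 ∷ p201 ∷ [])
  ∷ cert (0F ∷ 2F ∷ 1F ∷ 3F ∷ []) (0F ∷ 2F ∷ 1F ∷ 3F ∷ []) (p102 ∷ p012 ∷ p012 ∷ p210 ∷ [])
  ∷ cert (0F ∷ 1F ∷ 2F ∷ 3F ∷ []) (0F ∷ 1F ∷ 2F ∷ 3F ∷ []) (p102 ∷ p021 ∷ p012 ∷ p012 ∷ [])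
  ∷ cert (2F ∷ 0F ∷ 3F ∷ 1F ∷ []) (1F ∷ 3F ∷ 0F ∷ 2F ∷ []) (p102 ∷ p012 ∷ p012 ∷ p201 ∷ [])
  ∷ cert (0F ∷ 2F ∷ 1F ∷ 3F ∷ []) (0F ∷ 2F ∷ 1F ∷ 3F ∷ []) (p102 ∷ p012 ∷ p021 ∷ p210 ∷ [])
  ∷ cert (0F ∷ 1F ∷ 2F ∷ 3F ∷ []) (0F ∷ 1F ∷ 2F ∷ 3F ∷ []) (p012 ∷ p021 ∷ p012 ∷ p012 ∷ [])
  ∷ cert (2F ∷ 0F ∷ 3F ∷ 1F ∷ []) (1F ∷ 3F ∷ 0F ∷ 2F ∷ []) (p012 ∷ p012 ∷ p012 ∷ p201 ∷ [])
  ∷ cert (0F ∷ 2F ∷ 1F ∷ 3F ∷ []) (0F ∷ 2F ∷ 1F ∷ 3F ∷ []) (p012 ∷ p012 ∷ p021 ∷ p210 ∷ [])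
  ∷ cert (0F ∷ 1F ∷ 2F ∷ 3F ∷ []) (0F ∷ 1F ∷ 2F ∷ 3F ∷ []) (p012 ∷ p021 ∷ p021 ∷ p012 ∷ [])
  ∷ cert (2F ∷ 0F ∷ 3F ∷ 1F ∷ []) (1F ∷ 3F ∷ 0F ∷ 2F ∷ []) (p012 ∷ p012 ∷ p021 ∷ p201 ∷ [])
  ∷ cert (0F ∷ 2F ∷ 1F ∷ 3F ∷ []) (0F ∷ 2F ∷ 1F ∷ 3F ∷ []) (p012 ∷ p012 ∷ p012 ∷ p210 ∷ [])
  ∷ cert (0F ∷ 2F ∷ 1F ∷ 3F ∷ []) (0F ∷ 2F ∷ 1F ∷ 3F ∷ []) (p102 ∷ p021 ∷ p012 ∷ p210 ∷ [])
  ∷ cert (0F ∷ 2F ∷ 1F ∷ 3F ∷ []) (0F ∷ 2F ∷ 1F ∷ 3F ∷ []) (p012 ∷ p012 ∷ p012 ∷ p210 ∷ [])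
  ∷ cert (0F ∷ 1F ∷ 2F ∷ 3F ∷ []) (0F ∷ 1F ∷ 2F ∷ 3F ∷ []) (p102 ∷ p012 ∷ p021 ∷ p012 ∷ [])
  ∷ cert (2F ∷ 0F ∷ 3F ∷ 1F ∷ []) (1F ∷ 3F ∷ 0F ∷ 2F ∷ []) (p102 ∷ p021 ∷ p021 ∷ p201 ∷ [])
  ∷ cert (0F ∷ 2F ∷ 1F ∷ 3F ∷ []) (0F ∷ 2F ∷ 1F ∷ 3F ∷ []) (p102 ∷ p021 ∷ p012 ∷ p210 ∷ [])
  ∷ cert (0F ∷ 1F ∷ 2F ∷ 3F ∷ []) (0F ∷ 1F ∷ 2F ∷ 3F ∷ []) (p102 ∷ p012 ∷ p012 ∷ p012 ∷ [])
  ∷ cert (2F ∷ 0F ∷ 3F ∷ 1F ∷ []) (1F ∷ 3F ∷ 0F ∷ 2F ∷ []) (p102 ∷ p021 ∷ p012 ∷ p201 ∷ [])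
  ∷ cert (0F ∷ 2F ∷ 1F ∷ 3F ∷ []) (0F ∷ 2F ∷ 1F ∷ 3F ∷ []) (p102 ∷ p021 ∷ p021 ∷ p210 ∷ [])
  ∷ cert (0F ∷ 1F ∷ 2F ∷ 3F ∷ []) (0F ∷ 1F ∷ 2F ∷ 3F ∷ []) (p102 ∷ p012 ∷ p021 ∷ p012 ∷ [])
  ∷ cert (0F ∷ 1F ∷ 2F ∷ 3F ∷ []) (0F ∷ 1F ∷ 2F ∷ 3F ∷ []) (p102 ∷ p012 ∷ p012 ∷ p012 ∷ [])
  ∷ cert (1F ∷ 0F ∷ 2F ∷ 3F ∷ []) (1F ∷ 0F ∷ 2F ∷ 3F ∷ []) (p012 ∷ p210 ∷ p120 ∷ p120 ∷ [])
  ∷ cert (1F ∷ 0F ∷ 2F ∷ 3F ∷ []) (1F ∷ 0F ∷ 2F ∷ 3F ∷ []) (p012 ∷ p021 ∷ p201 ∷ p201 ∷ [])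
  ∷ cert (1F ∷ 0F ∷ 2F ∷ 3F ∷ []) (1F ∷ 0F ∷ 2F ∷ 3F ∷ []) (p012 ∷ p120 ∷ p102 ∷ p210 ∷ [])
  ∷ cert (1F ∷ 2F ∷ 0F ∷ 3F ∷ []) (2F ∷ 0F ∷ 1F ∷ 3F ∷ []) (p102 ∷ p210 ∷ p120 ∷ p012 ∷ [])
  ∷ cert (0F ∷ 3F ∷ 2F ∷ 1F ∷ []) (0F ∷ 3F ∷ 2F ∷ 1F ∷ []) (p021 ∷ p012 ∷ p021 ∷ p021 ∷ [])
  ∷ cert (1F ∷ 2F ∷ 0F ∷ 3F ∷ []) (2F ∷ 0F ∷ 1F ∷ 3F ∷ []) (p012 ∷ p012 ∷ p021 ∷ p210 ∷ [])
  ∷ cert (1F ∷ 0F ∷ 2F ∷ 3F ∷ []) (1F ∷ 0F ∷ 2F ∷ 3F ∷ []) (p012 ∷ p012 ∷ p021 ∷ p102 ∷ [])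
  ∷ cert (0F ∷ 1F ∷ 3F ∷ 2F ∷ []) (0F ∷ 1F ∷ 3F ∷ 2F ∷ []) (p021 ∷ p102 ∷ p201 ∷ p021 ∷ [])
  ∷ cert (1F ∷ 0F ∷ 2F ∷ 3F ∷ []) (1F ∷ 0F ∷ 2F ∷ 3F ∷ []) (p102 ∷ p021 ∷ p201 ∷ p021 ∷ [])
  ∷ cert (1F ∷ 0F ∷ 2F ∷ 3F ∷ []) (1F ∷ 0F ∷ 2F ∷ 3F ∷ []) (p012 ∷ p120 ∷ p102 ∷ p120 ∷ [])
  ∷ cert (1F ∷ 2F ∷ 0F ∷ 3F ∷ []) (2F ∷ 0F ∷ 1F ∷ 3F ∷ []) (p102 ∷ p120 ∷ p102 ∷ p021 ∷ [])
  ∷ cert (2F ∷ 1F ∷ 0F ∷ 3F ∷ []) (2F ∷ 1F ∷ 0F ∷ 3F ∷ []) (p021 ∷ p012 ∷ p201 ∷ p021 ∷ [])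
  ∷ cert (1F ∷ 2F ∷ 0F ∷ 3F ∷ []) (2F ∷ 0F ∷ 1F ∷ 3F ∷ []) (p012 ∷ p021 ∷ p201 ∷ p120 ∷ [])
  ∷ cert (1F ∷ 0F ∷ 2F ∷ 3F ∷ []) (1F ∷ 0F ∷ 2F ∷ 3F ∷ []) (p102 ∷ p012 ∷ p021 ∷ p012 ∷ [])
  ∷ cert (0F ∷ 2F ∷ 3F ∷ 1F ∷ []) (0F ∷ 3F ∷ 1F ∷ 2F ∷ []) (p120 ∷ p012 ∷ p021 ∷ p201 ∷ [])
  ∷ cert (1F ∷ 0F ∷ 2F ∷ 3F ∷ []) (1F ∷ 0F ∷ 2F ∷ 3F ∷ []) (p012 ∷ p210 ∷ p120 ∷ p210 ∷ [])
  ∷ cert (1F ∷ 0F ∷ 2F ∷ 3F ∷ []) (1F ∷ 0F ∷ 2F ∷ 3F ∷ []) (p012 ∷ p102 ∷ p012 ∷ p012 ∷ [])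
  ∷ cert (0F ∷ 1F ∷ 2F ∷ 3F ∷ []) (0F ∷ 1F ∷ 2F ∷ 3F ∷ []) (p012 ∷ p012 ∷ p012 ∷ p012 ∷ [])
  ∷ cert (1F ∷ 0F ∷ 2F ∷ 3F ∷ []) (1F ∷ 0F ∷ 2F ∷ 3F ∷ []) (p012 ∷ p012 ∷ p021 ∷ p012 ∷ [])
  ∷ cert (1F ∷ 2F ∷ 3F ∷ 0F ∷ []) (3F ∷ 0F ∷ 1F ∷ 2F ∷ []) (p012 ∷ p102 ∷ p012 ∷ p201 ∷ [])
  ∷ cert (0F ∷ 1F ∷ 2F ∷ 3F ∷ []) (0F ∷ 1F ∷ 2F ∷ 3F ∷ []) (p012 ∷ p120 ∷ p120 ∷ p120 ∷ [])
  ∷ cert (0F ∷ 1F ∷ 2F ∷ 3F ∷ []) (0F ∷ 1F ∷ 2F ∷ 3F ∷ []) (p102 ∷ p210 ∷ p102 ∷ p210 ∷ [])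
  ∷ cert (1F ∷ 2F ∷ 0F ∷ 3F ∷ []) (2F ∷ 0F ∷ 1F ∷ 3F ∷ []) (p012 ∷ p012 ∷ p021 ∷ p210 ∷ [])
  ∷ cert (0F ∷ 1F ∷ 2F ∷ 3F ∷ []) (0F ∷ 1F ∷ 2F ∷ 3F ∷ []) (p021 ∷ p012 ∷ p201 ∷ p021 ∷ [])
  ∷ cert (1F ∷ 0F ∷ 3F ∷ 2F ∷ []) (1F ∷ 0F ∷ 3F ∷ 2F ∷ []) (p102 ∷ p120 ∷ p201 ∷ p021 ∷ [])
  ∷ cert (1F ∷ 0F ∷ 3F ∷ 2F ∷ []) (1F ∷ 0F ∷ 3F ∷ 2F ∷ []) (p012 ∷ p021 ∷ p102 ∷ p120 ∷ [])
  ∷ cert (1F ∷ 0F ∷ 2F ∷ 3F ∷ []) (1F ∷ 0F ∷ 2F ∷ 3F ∷ []) (p102 ∷ p102 ∷ p012 ∷ p102 ∷ [])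
  ∷ cert (2F ∷ 0F ∷ 1F ∷ 3F ∷ []) (1F ∷ 2F ∷ 0F ∷ 3F ∷ []) (p120 ∷ p102 ∷ p021 ∷ p201 ∷ [])
  ∷ cert (1F ∷ 0F ∷ 2F ∷ 3F ∷ []) (1F ∷ 0F ∷ 2F ∷ 3F ∷ []) (p012 ∷ p201 ∷ p210 ∷ p201 ∷ [])
  ∷ cert (1F ∷ 2F ∷ 0F ∷ 3F ∷ []) (2F ∷ 0F ∷ 1F ∷ 3F ∷ []) (p012 ∷ p201 ∷ p210 ∷ p102 ∷ [])
  ∷ cert (1F ∷ 2F ∷ 0F ∷ 3F ∷ []) (2F ∷ 0F ∷ 1F ∷ 3F ∷ []) (p102 ∷ p102 ∷ p012 ∷ p201 ∷ [])
  ∷ cert (0F ∷ 3F ∷ 1F ∷ 2F ∷ []) (0F ∷ 2F ∷ 3F ∷ 1F ∷ []) (p021 ∷ p102 ∷ p201 ∷ p201 ∷ [])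
  ∷ cert (1F ∷ 0F ∷ 3F ∷ 2F ∷ []) (1F ∷ 0F ∷ 3F ∷ 2F ∷ []) (p012 ∷ p210 ∷ p021 ∷ p012 ∷ [])
  ∷ cert (2F ∷ 0F ∷ 3F ∷ 1F ∷ []) (1F ∷ 3F ∷ 0F ∷ 2F ∷ []) (p120 ∷ p012 ∷ p021 ∷ p201 ∷ [])
  ∷ cert (1F ∷ 0F ∷ 3F ∷ 2F ∷ []) (1F ∷ 0F ∷ 3F ∷ 2F ∷ []) (p102 ∷ p012 ∷ p120 ∷ p210 ∷ [])
  ∷ cert (1F ∷ 0F ∷ 3F ∷ 2F ∷ []) (1F ∷ 0F ∷ 3F ∷ 2F ∷ []) (p012 ∷ p201 ∷ p012 ∷ p102 ∷ [])
  ∷ cert (0F ∷ 2F ∷ 1F ∷ 3F ∷ []) (0F ∷ 2F ∷ 1F ∷ 3F ∷ []) (p120 ∷ p102 ∷ p021 ∷ p201 ∷ [])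
  ∷ cert (1F ∷ 0F ∷ 3F ∷ 2F ∷ []) (1F ∷ 0F ∷ 3F ∷ 2F ∷ []) (p102 ∷ p102 ∷ p210 ∷ p201 ∷ [])
  ∷ cert (1F ∷ 0F ∷ 2F ∷ 3F ∷ []) (1F ∷ 0F ∷ 2F ∷ 3F ∷ []) (p102 ∷ p201 ∷ p210 ∷ p021 ∷ [])
  ∷ cert (1F ∷ 0F ∷ 2F ∷ 3F ∷ []) (1F ∷ 0F ∷ 2F ∷ 3F ∷ []) (p012 ∷ p201 ∷ p210 ∷ p021 ∷ [])
  ∷ cert (1F ∷ 0F ∷ 3F ∷ 2F ∷ []) (1F ∷ 0F ∷ 3F ∷ 2F ∷ []) (p102 ∷ p201 ∷ p012 ∷ p102 ∷ [])
  ∷ cert (0F ∷ 2F ∷ 1F ∷ 3F ∷ []) (0F ∷ 2F ∷ 1F ∷ 3F ∷ []) (p021 ∷ p102 ∷ p021 ∷ p201 ∷ [])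
  ∷ cert (1F ∷ 0F ∷ 3F ∷ 2F ∷ []) (1F ∷ 0F ∷ 3F ∷ 2F ∷ []) (p012 ∷ p102 ∷ p210 ∷ p201 ∷ [])
  ∷ cert (1F ∷ 0F ∷ 3F ∷ 2F ∷ []) (1F ∷ 0F ∷ 3F ∷ 2F ∷ []) (p102 ∷ p210 ∷ p021 ∷ p012 ∷ [])
  ∷ cert (2F ∷ 0F ∷ 3F ∷ 1F ∷ []) (1F ∷ 3F ∷ 0F ∷ 2F ∷ []) (p021 ∷ p012 ∷ p021 ∷ p201 ∷ [])
  ∷ cert (1F ∷ 0F ∷ 3F ∷ 2F ∷ []) (1F ∷ 0F ∷ 3F ∷ 2F ∷ []) (p012 ∷ p012 ∷ p120 ∷ p210 ∷ [])
  ∷ cert (1F ∷ 2F ∷ 0F ∷ 3F ∷ []) (2F ∷ 0F ∷ 1F ∷ 3F ∷ []) (p102 ∷ p201 ∷ p210 ∷ p102 ∷ [])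
  ∷ cert (1F ∷ 2F ∷ 0F ∷ 3F ∷ []) (2F ∷ 0F ∷ 1F ∷ 3F ∷ []) (p012 ∷ p102 ∷ p012 ∷ p201 ∷ [])
  ∷ cert (0F ∷ 3F ∷ 1F ∷ 2F ∷ []) (0F ∷ 2F ∷ 3F ∷ 1F ∷ []) (p120 ∷ p102 ∷ p201 ∷ p201 ∷ [])
  ∷ cert (1F ∷ 0F ∷ 2F ∷ 3F ∷ []) (1F ∷ 0F ∷ 2F ∷ 3F ∷ []) (p012 ∷ p102 ∷ p012 ∷ p102 ∷ [])
  ∷ cert (2F ∷ 0F ∷ 1F ∷ 3F ∷ []) (1F ∷ 2F ∷ 0F ∷ 3F ∷ []) (p021 ∷ p102 ∷ p021 ∷ p201 ∷ [])
  ∷ cert (1F ∷ 0F ∷ 2F ∷ 3F ∷ []) (1F ∷ 0F ∷ 2F ∷ 3F ∷ []) (p102 ∷ p201 ∷ p210 ∷ p201 ∷ [])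
  ∷ cert (0F ∷ 1F ∷ 2F ∷ 3F ∷ []) (0F ∷ 1F ∷ 2F ∷ 3F ∷ []) (p120 ∷ p012 ∷ p201 ∷ p021 ∷ [])
  ∷ cert (1F ∷ 0F ∷ 3F ∷ 2F ∷ []) (1F ∷ 0F ∷ 3F ∷ 2F ∷ []) (p012 ∷ p120 ∷ p201 ∷ p021 ∷ [])
  ∷ cert (1F ∷ 0F ∷ 3F ∷ 2F ∷ []) (1F ∷ 0F ∷ 3F ∷ 2F ∷ []) (p102 ∷ p021 ∷ p102 ∷ p120 ∷ [])
  ∷ cert (0F ∷ 1F ∷ 2F ∷ 3F ∷ []) (0F ∷ 1F ∷ 2F ∷ 3F ∷ []) (p102 ∷ p012 ∷ p012 ∷ p012 ∷ [])
  ∷ cert (1F ∷ 0F ∷ 2F ∷ 3F ∷ []) (1F ∷ 0F ∷ 2F ∷ 3F ∷ []) (p102 ∷ p012 ∷ p021 ∷ p012 ∷ [])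
  ∷ cert (1F ∷ 2F ∷ 3F ∷ 0F ∷ []) (3F ∷ 0F ∷ 1F ∷ 2F ∷ []) (p102 ∷ p102 ∷ p012 ∷ p201 ∷ [])
  ∷ cert (0F ∷ 1F ∷ 2F ∷ 3F ∷ []) (0F ∷ 1F ∷ 2F ∷ 3F ∷ []) (p102 ∷ p120 ∷ p120 ∷ p120 ∷ [])
  ∷ cert (0F ∷ 1F ∷ 2F ∷ 3F ∷ []) (0F ∷ 1F ∷ 2F ∷ 3F ∷ []) (p012 ∷ p210 ∷ p102 ∷ p210 ∷ [])
  ∷ cert (1F ∷ 2F ∷ 0F ∷ 3F ∷ []) (2F ∷ 0F ∷ 1F ∷ 3F ∷ []) (p102 ∷ p012 ∷ p021 ∷ p210 ∷ [])
  ∷ cert (1F ∷ 0F ∷ 2F ∷ 3F ∷ []) (1F ∷ 0F ∷ 2F ∷ 3F ∷ []) (p102 ∷ p102 ∷ p012 ∷ p012 ∷ [])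
  ∷ cert (1F ∷ 0F ∷ 2F ∷ 3F ∷ []) (1F ∷ 0F ∷ 2F ∷ 3F ∷ []) (p012 ∷ p012 ∷ p021 ∷ p012 ∷ [])
  ∷ cert (0F ∷ 2F ∷ 3F ∷ 1F ∷ []) (0F ∷ 3F ∷ 1F ∷ 2F ∷ []) (p021 ∷ p012 ∷ p021 ∷ p201 ∷ [])
  ∷ cert (1F ∷ 0F ∷ 2F ∷ 3F ∷ []) (1F ∷ 0F ∷ 2F ∷ 3F ∷ []) (p102 ∷ p210 ∷ p120 ∷ p210 ∷ [])
  ∷ cert (1F ∷ 2F ∷ 0F ∷ 3F ∷ []) (2F ∷ 0F ∷ 1F ∷ 3F ∷ []) (p012 ∷ p120 ∷ p102 ∷ p021 ∷ [])
  ∷ cert (2F ∷ 1F ∷ 0F ∷ 3F ∷ []) (2F ∷ 1F ∷ 0F ∷ 3F ∷ []) (p120 ∷ p012 ∷ p201 ∷ p021 ∷ [])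
  ∷ cert (1F ∷ 2F ∷ 0F ∷ 3F ∷ []) (2F ∷ 0F ∷ 1F ∷ 3F ∷ []) (p102 ∷ p021 ∷ p201 ∷ p120 ∷ [])
  ∷ cert (0F ∷ 1F ∷ 3F ∷ 2F ∷ []) (0F ∷ 1F ∷ 3F ∷ 2F ∷ []) (p120 ∷ p102 ∷ p201 ∷ p021 ∷ [])
  ∷ cert (1F ∷ 0F ∷ 2F ∷ 3F ∷ []) (1F ∷ 0F ∷ 2F ∷ 3F ∷ []) (p012 ∷ p021 ∷ p201 ∷ p021 ∷ [])
  ∷ cert (1F ∷ 0F ∷ 2F ∷ 3F ∷ []) (1F ∷ 0F ∷ 2F ∷ 3F ∷ []) (p102 ∷ p120 ∷ p102 ∷ p120 ∷ [])
  ∷ cert (1F ∷ 0F ∷ 2F ∷ 3F ∷ []) (1F ∷ 0F ∷ 2F ∷ 3F ∷ []) (p102 ∷ p012 ∷ p021 ∷ p102 ∷ [])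
  ∷ cert (1F ∷ 2F ∷ 0F ∷ 3F ∷ []) (2F ∷ 0F ∷ 1F ∷ 3F ∷ []) (p012 ∷ p210 ∷ p120 ∷ p012 ∷ [])
  ∷ cert (0F ∷ 3F ∷ 2F ∷ 1F ∷ []) (0F ∷ 3F ∷ 2F ∷ 1F ∷ []) (p120 ∷ p012 ∷ p021 ∷ p021 ∷ [])
  ∷ cert (1F ∷ 2F ∷ 0F ∷ 3F ∷ []) (2F ∷ 0F ∷ 1F ∷ 3F ∷ []) (p102 ∷ p012 ∷ p021 ∷ p210 ∷ [])
  ∷ cert (1F ∷ 0F ∷ 2F ∷ 3F ∷ []) (1F ∷ 0F ∷ 2F ∷ 3F ∷ []) (p102 ∷ p120 ∷ p102 ∷ p210 ∷ [])
  ∷ cert (1F ∷ 0F ∷ 2F ∷ 3F ∷ []) (1F ∷ 0F ∷ 2F ∷ 3F ∷ []) (p102 ∷ p021 ∷ p201 ∷ p201 ∷ [])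
  ∷ cert (1F ∷ 0F ∷ 2F ∷ 3F ∷ []) (1F ∷ 0F ∷ 2F ∷ 3F ∷ []) (p102 ∷ p210 ∷ p120 ∷ p120 ∷ [])
  ∷ []

reps-4-8 : List (List (Word 4))
reps-4-8 =
  ((2F ∷ 2F ∷ 1F ∷ 2F ∷ []) ∷ (2F ∷ 0F ∷ 0F ∷ 0F ∷ []) ∷ (1F ∷ 0F ∷ 2F ∷ 2F ∷ []) ∷ (1F ∷ 1F ∷ 1F ∷ 2F ∷ []) ∷ (1F ∷ 0F ∷ 0F ∷ 1F ∷ []) ∷ (0F ∷ 1F ∷ 0F ∷ 0F ∷ []) ∷ (0F ∷ 2F ∷ 2F ∷ 0F ∷ []) ∷ (0F ∷ 2F ∷ 1F ∷ 1F ∷ []) ∷ [])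
  ∷ ((2F ∷ 1F ∷ 2F ∷ 1F ∷ []) ∷ (2F ∷ 0F ∷ 1F ∷ 0F ∷ []) ∷ (0F ∷ 0F ∷ 2F ∷ 2F ∷ []) ∷ (1F ∷ 1F ∷ 1F ∷ 2F ∷ []) ∷ (1F ∷ 0F ∷ 0F ∷ 1F ∷ []) ∷ (0F ∷ 1F ∷ 0F ∷ 0F ∷ []) ∷ (1F ∷ 2F ∷ 2F ∷ 0F ∷ []) ∷ (0F ∷ 2F ∷ 1F ∷ 1F ∷ []) ∷ [])
  ∷ []

certs-4-8 : List (Certificate 4)
certs-4-8 =
  cert (0F ∷ 1F ∷ 2F ∷ 3F ∷ []) (0F ∷ 1F ∷ 2F ∷ 3F ∷ []) (p012 ∷ p012 ∷ p012 ∷ p012 ∷ [])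
  ∷ cert (0F ∷ 1F ∷ 2F ∷ 3F ∷ []) (0F ∷ 1F ∷ 2F ∷ 3F ∷ []) (p012 ∷ p102 ∷ p021 ∷ p102 ∷ [])
  ∷ cert (0F ∷ 1F ∷ 3F ∷ 2F ∷ []) (0F ∷ 1F ∷ 3F ∷ 2F ∷ []) (p102 ∷ p210 ∷ p021 ∷ p021 ∷ [])
  ∷ cert (0F ∷ 1F ∷ 3F ∷ 2F ∷ []) (0F ∷ 1F ∷ 3F ∷ 2F ∷ []) (p102 ∷ p201 ∷ p012 ∷ p120 ∷ [])
  ∷ cert (0F ∷ 2F ∷ 1F ∷ 3F ∷ []) (0F ∷ 2F ∷ 1F ∷ 3F ∷ []) (p012 ∷ p210 ∷ p210 ∷ p102 ∷ [])
  ∷ cert (0F ∷ 1F ∷ 3F ∷ 2F ∷ []) (0F ∷ 1F ∷ 3F ∷ 2F ∷ []) (p102 ∷ p120 ∷ p201 ∷ p012 ∷ [])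
  ∷ cert (0F ∷ 1F ∷ 2F ∷ 3F ∷ []) (0F ∷ 1F ∷ 2F ∷ 3F ∷ []) (p012 ∷ p012 ∷ p012 ∷ p012 ∷ [])
  ∷ cert (0F ∷ 1F ∷ 2F ∷ 3F ∷ []) (0F ∷ 1F ∷ 2F ∷ 3F ∷ []) (p102 ∷ p021 ∷ p210 ∷ p021 ∷ [])
  ∷ cert (0F ∷ 1F ∷ 2F ∷ 3F ∷ []) (0F ∷ 1F ∷ 2F ∷ 3F ∷ []) (p012 ∷ p120 ∷ p120 ∷ p120 ∷ [])
  ∷ cert (0F ∷ 2F ∷ 1F ∷ 3F ∷ []) (0F ∷ 2F ∷ 1F ∷ 3F ∷ []) (p102 ∷ p102 ∷ p102 ∷ p021 ∷ [])
  ∷ cert (0F ∷ 1F ∷ 2F ∷ 3F ∷ []) (0F ∷ 1F ∷ 2F ∷ 3F ∷ []) (p102 ∷ p021 ∷ p210 ∷ p021 ∷ [])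
  ∷ cert (0F ∷ 2F ∷ 1F ∷ 3F ∷ []) (0F ∷ 2F ∷ 1F ∷ 3F ∷ []) (p102 ∷ p201 ∷ p120 ∷ p012 ∷ [])
  ∷ cert (0F ∷ 2F ∷ 1F ∷ 3F ∷ []) (0F ∷ 2F ∷ 1F ∷ 3F ∷ []) (p012 ∷ p201 ∷ p120 ∷ p012 ∷ [])
  ∷ cert (0F ∷ 1F ∷ 2F ∷ 3F ∷ []) (0F ∷ 1F ∷ 2F ∷ 3F ∷ []) (p012 ∷ p021 ∷ p210 ∷ p021 ∷ [])
  ∷ cert (0F ∷ 2F ∷ 1F ∷ 3F ∷ []) (0F ∷ 2F ∷ 1F ∷ 3F ∷ []) (p012 ∷ p102 ∷ p102 ∷ p021 ∷ [])
  ∷ cert (0F ∷ 1F ∷ 2F ∷ 3F ∷ []) (0F ∷ 1F ∷ 2F ∷ 3F ∷ []) (p102 ∷ p012 ∷ p012 ∷ p012 ∷ [])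
  ∷ cert (0F ∷ 1F ∷ 2F ∷ 3F ∷ []) (0F ∷ 1F ∷ 2F ∷ 3F ∷ []) (p012 ∷ p021 ∷ p210 ∷ p021 ∷ [])
  ∷ cert (0F ∷ 1F ∷ 2F ∷ 3F ∷ []) (0F ∷ 1F ∷ 2F ∷ 3F ∷ []) (p102 ∷ p120 ∷ p120 ∷ p120 ∷ [])
  ∷ cert (0F ∷ 1F ∷ 3F ∷ 2F ∷ []) (0F ∷ 1F ∷ 3F ∷ 2F ∷ []) (p012 ∷ p120 ∷ p201 ∷ p012 ∷ [])
  ∷ cert (0F ∷ 2F ∷ 1F ∷ 3F ∷ []) (0F ∷ 2F ∷ 1F ∷ 3F ∷ []) (p102 ∷ p210 ∷ p210 ∷ p102 ∷ [])
  ∷ cert (0F ∷ 1F ∷ 3F ∷ 2F ∷ []) (0F ∷ 1F ∷ 3F ∷ 2F ∷ []) (p012 ∷ p201 ∷ p012 ∷ p120 ∷ [])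
  ∷ cert (0F ∷ 1F ∷ 3F ∷ 2F ∷ []) (0F ∷ 1F ∷ 3F ∷ 2F ∷ []) (p012 ∷ p210 ∷ p021 ∷ p021 ∷ [])
  ∷ cert (0F ∷ 1F ∷ 2F ∷ 3F ∷ []) (0F ∷ 1F ∷ 2F ∷ 3F ∷ []) (p102 ∷ p102 ∷ p021 ∷ p102 ∷ [])
  ∷ cert (0F ∷ 1F ∷ 2F ∷ 3F ∷ []) (0F ∷ 1F ∷ 2F ∷ 3F ∷ []) (p102 ∷ p012 ∷ p012 ∷ p012 ∷ [])
  ∷ []

reps-5-10 : List (List (Word 5))
reps-5-10 =
  ((2F ∷ 2F ∷ 0F ∷ 0F ∷ 2F ∷ []) ∷ (2F ∷ 0F ∷ 0F ∷ 2F ∷ 1F ∷ []) ∷ (2F ∷ 1F ∷ 0F ∷ 1F ∷ 0F ∷ []) ∷ (0F ∷ 0F ∷ 2F ∷ 0F ∷ 0F ∷ []) ∷ (0F ∷ 0F ∷ 1F ∷ 0F ∷ 0F ∷ []) ∷ (1F ∷ 1F ∷ 0F ∷ 0F ∷ 1F ∷ []) ∷ (1F ∷ 0F ∷ 0F ∷ 1F ∷ 2F ∷ []) ∷ (0F ∷ 1F ∷ 0F ∷ 2F ∷ 2F ∷ []) ∷ (1F ∷ 2F ∷ 0F ∷ 2F ∷ 0F ∷ []) ∷ (0F ∷ 2F ∷ 0F ∷ 1F ∷ 1F ∷ []) ∷ [])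
  ∷ ((2F ∷ 2F ∷ 1F ∷ 0F ∷ 2F ∷ []) ∷ (2F ∷ 0F ∷ 1F ∷ 2F ∷ 1F ∷ []) ∷ (2F ∷ 1F ∷ 1F ∷ 1F ∷ 0F ∷ []) ∷ (1F ∷ 0F ∷ 2F ∷ 0F ∷ 0F ∷ []) ∷ (0F ∷ 0F ∷ 1F ∷ 0F ∷ 0F ∷ []) ∷ (1F ∷ 1F ∷ 0F ∷ 0F ∷ 1F ∷ []) ∷ (1F ∷ 0F ∷ 0F ∷ 1F ∷ 2F ∷ []) ∷ (0F ∷ 1F ∷ 0F ∷ 2F ∷ 2F ∷ []) ∷ (1F ∷ 2F ∷ 0F ∷ 2F ∷ 0F ∷ []) ∷ (0F ∷ 2F ∷ 0F ∷ 1F ∷ 1F ∷ []) ∷ [])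
  ∷ ((1F ∷ 2F ∷ 2F ∷ 2F ∷ 2F ∷ []) ∷ (2F ∷ 0F ∷ 1F ∷ 2F ∷ 2F ∷ []) ∷ (2F ∷ 2F ∷ 0F ∷ 0F ∷ 0F ∷ []) ∷ (0F ∷ 0F ∷ 2F ∷ 0F ∷ 0F ∷ []) ∷ (1F ∷ 1F ∷ 1F ∷ 0F ∷ 0F ∷ []) ∷ (1F ∷ 0F ∷ 0F ∷ 0F ∷ 1F ∷ []) ∷ (1F ∷ 0F ∷ 0F ∷ 1F ∷ 2F ∷ []) ∷ (0F ∷ 1F ∷ 0F ∷ 2F ∷ 2F ∷ []) ∷ (0F ∷ 2F ∷ 1F ∷ 1F ∷ 0F ∷ []) ∷ (0F ∷ 2F ∷ 1F ∷ 2F ∷ 1F ∷ []) ∷ [])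
  ∷ ((0F ∷ 2F ∷ 2F ∷ 2F ∷ 2F ∷ []) ∷ (2F ∷ 0F ∷ 0F ∷ 2F ∷ 2F ∷ []) ∷ (2F ∷ 2F ∷ 1F ∷ 0F ∷ 0F ∷ []) ∷ (1F ∷ 0F ∷ 2F ∷ 0F ∷ 0F ∷ []) ∷ (1F ∷ 1F ∷ 1F ∷ 0F ∷ 0F ∷ []) ∷ (1F ∷ 0F ∷ 0F ∷ 0F ∷ 1F ∷ []) ∷ (1F ∷ 0F ∷ 0F ∷ 1F ∷ 2F ∷ []) ∷ (0F ∷ 1F ∷ 0F ∷ 2F ∷ 2F ∷ []) ∷ (0F ∷ 2F ∷ 1F ∷ 1F ∷ 0F ∷ []) ∷ (0F ∷ 2F ∷ 1F ∷ 2F ∷ 1F ∷ []) ∷ [])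
  ∷ ((2F ∷ 2F ∷ 1F ∷ 0F ∷ 2F ∷ []) ∷ (2F ∷ 2F ∷ 2F ∷ 1F ∷ 1F ∷ []) ∷ (2F ∷ 0F ∷ 0F ∷ 2F ∷ 0F ∷ []) ∷ (0F ∷ 0F ∷ 2F ∷ 0F ∷ 0F ∷ []) ∷ (0F ∷ 1F ∷ 1F ∷ 0F ∷ 0F ∷ []) ∷ (1F ∷ 0F ∷ 0F ∷ 0F ∷ 1F ∷ []) ∷ (0F ∷ 0F ∷ 0F ∷ 1F ∷ 2F ∷ []) ∷ (1F ∷ 1F ∷ 0F ∷ 2F ∷ 2F ∷ []) ∷ (1F ∷ 2F ∷ 1F ∷ 1F ∷ 0F ∷ []) ∷ (0F ∷ 2F ∷ 1F ∷ 2F ∷ 1F ∷ []) ∷ [])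
  ∷ []

certs-5-10 : List (Certificate 5)
certs-5-10 =
  cert (0F ∷ 1F ∷ 2F ∷ 3F ∷ 4F ∷ []) (0F ∷ 1F ∷ 2F ∷ 3F ∷ 4F ∷ []) (p012 ∷ p012 ∷ p012 ∷ p012 ∷ p012 ∷ [])
  ∷ cert (0F ∷ 1F ∷ 2F ∷ 3F ∷ 4F ∷ []) (0F ∷ 1F ∷ 2F ∷ 3F ∷ 4F ∷ []) (p012 ∷ p012 ∷ p012 ∷ p012 ∷ p012 ∷ [])
  ∷ cert (0F ∷ 1F ∷ 2F ∷ 3F ∷ 4F ∷ []) (0F ∷ 1F ∷ 2F ∷ 3F ∷ 4F ∷ []) (p012 ∷ p012 ∷ p021 ∷ p012 ∷ p012 ∷ [])
  ∷ cert (0F ∷ 1F ∷ 2F ∷ 3F ∷ 4F ∷ []) (0F ∷ 1F ∷ 2F ∷ 3F ∷ 4F ∷ []) (p102 ∷ p012 ∷ p021 ∷ p012 ∷ p012 ∷ [])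
  ∷ cert (0F ∷ 1F ∷ 2F ∷ 3F ∷ 4F ∷ []) (0F ∷ 1F ∷ 2F ∷ 3F ∷ 4F ∷ []) (p102 ∷ p012 ∷ p012 ∷ p012 ∷ p012 ∷ [])
  ∷ cert (0F ∷ 1F ∷ 2F ∷ 3F ∷ 4F ∷ []) (0F ∷ 1F ∷ 2F ∷ 3F ∷ 4F ∷ []) (p102 ∷ p012 ∷ p012 ∷ p012 ∷ p012 ∷ [])
  ∷ cert (0F ∷ 1F ∷ 2F ∷ 3F ∷ 4F ∷ []) (0F ∷ 1F ∷ 2F ∷ 3F ∷ 4F ∷ []) (p012 ∷ p012 ∷ p012 ∷ p012 ∷ p012 ∷ [])
  ∷ cert (0F ∷ 1F ∷ 2F ∷ 3F ∷ 4F ∷ []) (0F ∷ 1F ∷ 2F ∷ 3F ∷ 4F ∷ []) (p012 ∷ p012 ∷ p012 ∷ p012 ∷ p012 ∷ [])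
  ∷ cert (0F ∷ 2F ∷ 1F ∷ 4F ∷ 3F ∷ []) (0F ∷ 2F ∷ 1F ∷ 4F ∷ 3F ∷ []) (p012 ∷ p021 ∷ p021 ∷ p210 ∷ p210 ∷ [])
  ∷ cert (0F ∷ 1F ∷ 3F ∷ 2F ∷ 4F ∷ []) (0F ∷ 1F ∷ 3F ∷ 2F ∷ 4F ∷ []) (p102 ∷ p210 ∷ p120 ∷ p201 ∷ p012 ∷ [])
  ∷ cert (0F ∷ 3F ∷ 1F ∷ 4F ∷ 2F ∷ []) (0F ∷ 2F ∷ 4F ∷ 1F ∷ 3F ∷ []) (p012 ∷ p210 ∷ p120 ∷ p210 ∷ p021 ∷ [])
  ∷ cert (0F ∷ 2F ∷ 4F ∷ 1F ∷ 3F ∷ []) (0F ∷ 3F ∷ 1F ∷ 4F ∷ 2F ∷ []) (p102 ∷ p201 ∷ p021 ∷ p210 ∷ p210 ∷ [])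
  ∷ cert (1F ∷ 0F ∷ 2F ∷ 3F ∷ 4F ∷ []) (1F ∷ 0F ∷ 2F ∷ 3F ∷ 4F ∷ []) (p012 ∷ p102 ∷ p012 ∷ p012 ∷ p012 ∷ [])
  ∷ cert (0F ∷ 1F ∷ 2F ∷ 3F ∷ 4F ∷ []) (0F ∷ 1F ∷ 2F ∷ 3F ∷ 4F ∷ []) (p012 ∷ p012 ∷ p012 ∷ p012 ∷ p012 ∷ [])
  ∷ cert (0F ∷ 3F ∷ 4F ∷ 1F ∷ 2F ∷ []) (0F ∷ 3F ∷ 4F ∷ 1F ∷ 2F ∷ []) (p012 ∷ p210 ∷ p120 ∷ p210 ∷ p201 ∷ [])
  ∷ cert (1F ∷ 3F ∷ 2F ∷ 4F ∷ 0F ∷ []) (4F ∷ 0F ∷ 2F ∷ 1F ∷ 3F ∷ []) (p120 ∷ p021 ∷ p102 ∷ p021 ∷ p102 ∷ [])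
  ∷ cert (0F ∷ 4F ∷ 1F ∷ 3F ∷ 2F ∷ []) (0F ∷ 2F ∷ 4F ∷ 3F ∷ 1F ∷ []) (p120 ∷ p021 ∷ p021 ∷ p021 ∷ p201 ∷ [])
  ∷ cert (0F ∷ 1F ∷ 3F ∷ 2F ∷ 4F ∷ []) (0F ∷ 1F ∷ 3F ∷ 2F ∷ 4F ∷ []) (p102 ∷ p210 ∷ p120 ∷ p201 ∷ p012 ∷ [])
  ∷ cert (1F ∷ 3F ∷ 2F ∷ 4F ∷ 0F ∷ []) (4F ∷ 0F ∷ 2F ∷ 1F ∷ 3F ∷ []) (p021 ∷ p021 ∷ p102 ∷ p021 ∷ p102 ∷ [])
  ∷ cert (0F ∷ 4F ∷ 1F ∷ 3F ∷ 2F ∷ []) (0F ∷ 2F ∷ 4F ∷ 3F ∷ 1F ∷ []) (p021 ∷ p021 ∷ p021 ∷ p021 ∷ p201 ∷ [])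
  ∷ cert (0F ∷ 1F ∷ 3F ∷ 2F ∷ 4F ∷ []) (0F ∷ 1F ∷ 3F ∷ 2F ∷ 4F ∷ []) (p012 ∷ p210 ∷ p120 ∷ p201 ∷ p012 ∷ [])
  ∷ cert (1F ∷ 0F ∷ 2F ∷ 3F ∷ 4F ∷ []) (1F ∷ 0F ∷ 2F ∷ 3F ∷ 4F ∷ []) (p102 ∷ p102 ∷ p012 ∷ p012 ∷ p012 ∷ [])
  ∷ cert (0F ∷ 1F ∷ 2F ∷ 3F ∷ 4F ∷ []) (0F ∷ 1F ∷ 2F ∷ 3F ∷ 4F ∷ []) (p102 ∷ p012 ∷ p012 ∷ p012 ∷ p012 ∷ [])
  ∷ cert (0F ∷ 3F ∷ 4F ∷ 1F ∷ 2F ∷ []) (0F ∷ 3F ∷ 4F ∷ 1F ∷ 2F ∷ []) (p102 ∷ p210 ∷ p120 ∷ p210 ∷ p201 ∷ [])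
  ∷ cert (0F ∷ 2F ∷ 4F ∷ 1F ∷ 3F ∷ []) (0F ∷ 3F ∷ 1F ∷ 4F ∷ 2F ∷ []) (p012 ∷ p201 ∷ p021 ∷ p210 ∷ p210 ∷ [])
  ∷ cert (0F ∷ 3F ∷ 1F ∷ 4F ∷ 2F ∷ []) (0F ∷ 2F ∷ 4F ∷ 1F ∷ 3F ∷ []) (p102 ∷ p210 ∷ p120 ∷ p210 ∷ p021 ∷ [])
  ∷ cert (0F ∷ 1F ∷ 3F ∷ 2F ∷ 4F ∷ []) (0F ∷ 1F ∷ 3F ∷ 2F ∷ 4F ∷ []) (p012 ∷ p210 ∷ p120 ∷ p201 ∷ p012 ∷ [])
  ∷ cert (0F ∷ 2F ∷ 1F ∷ 4F ∷ 3F ∷ []) (0F ∷ 2F ∷ 1F ∷ 4F ∷ 3F ∷ []) (p102 ∷ p021 ∷ p021 ∷ p210 ∷ p210 ∷ [])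
  ∷ cert (0F ∷ 1F ∷ 2F ∷ 3F ∷ 4F ∷ []) (0F ∷ 1F ∷ 2F ∷ 3F ∷ 4F ∷ []) (p102 ∷ p012 ∷ p012 ∷ p012 ∷ p012 ∷ [])
  ∷ cert (0F ∷ 1F ∷ 2F ∷ 3F ∷ 4F ∷ []) (0F ∷ 1F ∷ 2F ∷ 3F ∷ 4F ∷ []) (p102 ∷ p012 ∷ p012 ∷ p012 ∷ p012 ∷ [])
  ∷ cert (2F ∷ 0F ∷ 1F ∷ 3F ∷ 4F ∷ []) (1F ∷ 2F ∷ 0F ∷ 3F ∷ 4F ∷ []) (p012 ∷ p201 ∷ p201 ∷ p021 ∷ p210 ∷ [])
  ∷ cert (2F ∷ 0F ∷ 1F ∷ 3F ∷ 4F ∷ []) (1F ∷ 2F ∷ 0F ∷ 3F ∷ 4F ∷ []) (p012 ∷ p210 ∷ p102 ∷ p201 ∷ p120 ∷ [])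
  ∷ cert (2F ∷ 0F ∷ 1F ∷ 3F ∷ 4F ∷ []) (1F ∷ 2F ∷ 0F ∷ 3F ∷ 4F ∷ []) (p012 ∷ p012 ∷ p201 ∷ p210 ∷ p021 ∷ [])
  ∷ cert (2F ∷ 0F ∷ 1F ∷ 3F ∷ 4F ∷ []) (1F ∷ 2F ∷ 0F ∷ 3F ∷ 4F ∷ []) (p012 ∷ p102 ∷ p102 ∷ p012 ∷ p012 ∷ [])
  ∷ cert (2F ∷ 0F ∷ 1F ∷ 3F ∷ 4F ∷ []) (1F ∷ 2F ∷ 0F ∷ 3F ∷ 4F ∷ []) (p012 ∷ p012 ∷ p012 ∷ p021 ∷ p102 ∷ [])
  ∷ cert (2F ∷ 1F ∷ 3F ∷ 0F ∷ 4F ∷ []) (3F ∷ 1F ∷ 0F ∷ 2F ∷ 4F ∷ []) (p012 ∷ p201 ∷ p102 ∷ p210 ∷ p120 ∷ [])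
  ∷ cert (1F ∷ 0F ∷ 3F ∷ 2F ∷ 4F ∷ []) (1F ∷ 0F ∷ 3F ∷ 2F ∷ 4F ∷ []) (p120 ∷ p021 ∷ p201 ∷ p012 ∷ p021 ∷ [])
  ∷ cert (2F ∷ 1F ∷ 3F ∷ 0F ∷ 4F ∷ []) (3F ∷ 1F ∷ 0F ∷ 2F ∷ 4F ∷ []) (p012 ∷ p012 ∷ p210 ∷ p210 ∷ p012 ∷ [])
  ∷ cert (3F ∷ 0F ∷ 2F ∷ 4F ∷ 1F ∷ []) (1F ∷ 4F ∷ 2F ∷ 0F ∷ 3F ∷ []) (p021 ∷ p012 ∷ p021 ∷ p120 ∷ p210 ∷ [])
  ∷ cert (1F ∷ 0F ∷ 3F ∷ 2F ∷ 4F ∷ []) (1F ∷ 0F ∷ 3F ∷ 2F ∷ 4F ∷ []) (p021 ∷ p120 ∷ p021 ∷ p102 ∷ p201 ∷ [])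
  ∷ cert (2F ∷ 1F ∷ 3F ∷ 0F ∷ 4F ∷ []) (3F ∷ 1F ∷ 0F ∷ 2F ∷ 4F ∷ []) (p102 ∷ p102 ∷ p012 ∷ p201 ∷ p210 ∷ [])
  ∷ cert (2F ∷ 0F ∷ 1F ∷ 3F ∷ 4F ∷ []) (1F ∷ 2F ∷ 0F ∷ 3F ∷ 4F ∷ []) (p012 ∷ p012 ∷ p120 ∷ p102 ∷ p210 ∷ [])
  ∷ cert (2F ∷ 1F ∷ 0F ∷ 3F ∷ 4F ∷ []) (2F ∷ 1F ∷ 0F ∷ 3F ∷ 4F ∷ []) (p012 ∷ p201 ∷ p201 ∷ p012 ∷ p210 ∷ [])
  ∷ cert (3F ∷ 0F ∷ 4F ∷ 2F ∷ 1F ∷ []) (1F ∷ 4F ∷ 3F ∷ 0F ∷ 2F ∷ []) (p021 ∷ p012 ∷ p021 ∷ p120 ∷ p120 ∷ [])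
  ∷ cert (1F ∷ 0F ∷ 2F ∷ 3F ∷ 4F ∷ []) (1F ∷ 0F ∷ 2F ∷ 3F ∷ 4F ∷ []) (p120 ∷ p021 ∷ p102 ∷ p210 ∷ p012 ∷ [])
  ∷ cert (2F ∷ 1F ∷ 0F ∷ 3F ∷ 4F ∷ []) (2F ∷ 1F ∷ 0F ∷ 3F ∷ 4F ∷ []) (p012 ∷ p012 ∷ p201 ∷ p201 ∷ p021 ∷ [])
  ∷ cert (1F ∷ 0F ∷ 2F ∷ 3F ∷ 4F ∷ []) (1F ∷ 0F ∷ 2F ∷ 3F ∷ 4F ∷ []) (p021 ∷ p120 ∷ p012 ∷ p120 ∷ p102 ∷ [])
  ∷ cert (2F ∷ 1F ∷ 0F ∷ 3F ∷ 4F ∷ []) (2F ∷ 1F ∷ 0F ∷ 3F ∷ 4F ∷ []) (p102 ∷ p102 ∷ p210 ∷ p102 ∷ p120 ∷ [])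
  ∷ cert (3F ∷ 4F ∷ 0F ∷ 2F ∷ 1F ∷ []) (2F ∷ 4F ∷ 3F ∷ 0F ∷ 1F ∷ []) (p120 ∷ p021 ∷ p012 ∷ p210 ∷ p120 ∷ [])
  ∷ cert (0F ∷ 2F ∷ 1F ∷ 3F ∷ 4F ∷ []) (0F ∷ 2F ∷ 1F ∷ 3F ∷ 4F ∷ []) (p201 ∷ p102 ∷ p021 ∷ p120 ∷ p012 ∷ [])
  ∷ cert (1F ∷ 2F ∷ 0F ∷ 4F ∷ 3F ∷ []) (2F ∷ 0F ∷ 1F ∷ 4F ∷ 3F ∷ []) (p021 ∷ p102 ∷ p012 ∷ p102 ∷ p021 ∷ [])
  ∷ cert (1F ∷ 2F ∷ 0F ∷ 3F ∷ 4F ∷ []) (2F ∷ 0F ∷ 1F ∷ 3F ∷ 4F ∷ []) (p021 ∷ p102 ∷ p021 ∷ p120 ∷ p012 ∷ [])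
  ∷ cert (2F ∷ 0F ∷ 1F ∷ 3F ∷ 4F ∷ []) (1F ∷ 2F ∷ 0F ∷ 3F ∷ 4F ∷ []) (p102 ∷ p201 ∷ p012 ∷ p102 ∷ p021 ∷ [])
  ∷ cert (3F ∷ 4F ∷ 0F ∷ 1F ∷ 2F ∷ []) (2F ∷ 3F ∷ 4F ∷ 0F ∷ 1F ∷ []) (p021 ∷ p120 ∷ p201 ∷ p120 ∷ p021 ∷ [])
  ∷ cert (1F ∷ 2F ∷ 0F ∷ 4F ∷ 3F ∷ []) (2F ∷ 0F ∷ 1F ∷ 4F ∷ 3F ∷ []) (p120 ∷ p012 ∷ p210 ∷ p012 ∷ p201 ∷ [])
  ∷ cert (1F ∷ 2F ∷ 0F ∷ 3F ∷ 4F ∷ []) (2F ∷ 0F ∷ 1F ∷ 3F ∷ 4F ∷ []) (p120 ∷ p012 ∷ p120 ∷ p210 ∷ p102 ∷ [])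
  ∷ cert (2F ∷ 0F ∷ 1F ∷ 3F ∷ 4F ∷ []) (1F ∷ 2F ∷ 0F ∷ 3F ∷ 4F ∷ []) (p012 ∷ p210 ∷ p102 ∷ p201 ∷ p120 ∷ [])
  ∷ cert (2F ∷ 0F ∷ 1F ∷ 3F ∷ 4F ∷ []) (1F ∷ 2F ∷ 0F ∷ 3F ∷ 4F ∷ []) (p012 ∷ p210 ∷ p210 ∷ p012 ∷ p201 ∷ [])
  ∷ cert (2F ∷ 1F ∷ 0F ∷ 3F ∷ 4F ∷ []) (2F ∷ 1F ∷ 0F ∷ 3F ∷ 4F ∷ []) (p012 ∷ p021 ∷ p021 ∷ p021 ∷ p120 ∷ [])
  ∷ cert (2F ∷ 1F ∷ 3F ∷ 0F ∷ 4F ∷ []) (3F ∷ 1F ∷ 0F ∷ 2F ∷ 4F ∷ []) (p012 ∷ p021 ∷ p120 ∷ p120 ∷ p210 ∷ [])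
  ∷ cert (2F ∷ 0F ∷ 1F ∷ 3F ∷ 4F ∷ []) (1F ∷ 2F ∷ 0F ∷ 3F ∷ 4F ∷ []) (p012 ∷ p120 ∷ p120 ∷ p021 ∷ p021 ∷ [])
  ∷ cert (2F ∷ 0F ∷ 1F ∷ 3F ∷ 4F ∷ []) (1F ∷ 2F ∷ 0F ∷ 3F ∷ 4F ∷ []) (p012 ∷ p102 ∷ p021 ∷ p201 ∷ p201 ∷ [])
  ∷ cert (2F ∷ 1F ∷ 3F ∷ 0F ∷ 4F ∷ []) (3F ∷ 1F ∷ 0F ∷ 2F ∷ 4F ∷ []) (p012 ∷ p210 ∷ p201 ∷ p012 ∷ p210 ∷ [])
  ∷ cert (3F ∷ 0F ∷ 2F ∷ 4F ∷ 1F ∷ []) (1F ∷ 4F ∷ 2F ∷ 0F ∷ 3F ∷ []) (p021 ∷ p102 ∷ p012 ∷ p102 ∷ p120 ∷ [])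
  ∷ cert (2F ∷ 1F ∷ 3F ∷ 0F ∷ 4F ∷ []) (3F ∷ 1F ∷ 0F ∷ 2F ∷ 4F ∷ []) (p012 ∷ p102 ∷ p120 ∷ p012 ∷ p021 ∷ [])
  ∷ cert (1F ∷ 0F ∷ 3F ∷ 2F ∷ 4F ∷ []) (1F ∷ 0F ∷ 3F ∷ 2F ∷ 4F ∷ []) (p120 ∷ p120 ∷ p102 ∷ p210 ∷ p012 ∷ [])
  ∷ cert (2F ∷ 1F ∷ 3F ∷ 0F ∷ 4F ∷ []) (3F ∷ 1F ∷ 0F ∷ 2F ∷ 4F ∷ []) (p102 ∷ p012 ∷ p021 ∷ p021 ∷ p120 ∷ [])
  ∷ cert (1F ∷ 0F ∷ 3F ∷ 2F ∷ 4F ∷ []) (1F ∷ 0F ∷ 3F ∷ 2F ∷ 4F ∷ []) (p021 ∷ p021 ∷ p012 ∷ p120 ∷ p102 ∷ [])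
  ∷ cert (3F ∷ 0F ∷ 1F ∷ 4F ∷ 2F ∷ []) (1F ∷ 2F ∷ 4F ∷ 0F ∷ 3F ∷ []) (p120 ∷ p102 ∷ p021 ∷ p201 ∷ p102 ∷ [])
  ∷ cert (2F ∷ 1F ∷ 3F ∷ 0F ∷ 4F ∷ []) (3F ∷ 1F ∷ 0F ∷ 2F ∷ 4F ∷ []) (p102 ∷ p120 ∷ p102 ∷ p021 ∷ p012 ∷ [])
  ∷ cert (1F ∷ 0F ∷ 4F ∷ 2F ∷ 3F ∷ []) (1F ∷ 0F ∷ 3F ∷ 4F ∷ 2F ∷ []) (p021 ∷ p120 ∷ p102 ∷ p120 ∷ p012 ∷ [])
  ∷ cert (2F ∷ 1F ∷ 3F ∷ 0F ∷ 4F ∷ []) (3F ∷ 1F ∷ 0F ∷ 2F ∷ 4F ∷ []) (p012 ∷ p021 ∷ p012 ∷ p012 ∷ p102 ∷ [])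
  ∷ cert (1F ∷ 0F ∷ 4F ∷ 2F ∷ 3F ∷ []) (1F ∷ 0F ∷ 3F ∷ 4F ∷ 2F ∷ []) (p120 ∷ p021 ∷ p012 ∷ p210 ∷ p102 ∷ [])
  ∷ cert (1F ∷ 0F ∷ 4F ∷ 2F ∷ 3F ∷ []) (1F ∷ 0F ∷ 3F ∷ 4F ∷ 2F ∷ []) (p021 ∷ p021 ∷ p201 ∷ p102 ∷ p021 ∷ [])
  ∷ cert (2F ∷ 1F ∷ 3F ∷ 0F ∷ 4F ∷ []) (3F ∷ 1F ∷ 0F ∷ 2F ∷ 4F ∷ []) (p102 ∷ p021 ∷ p201 ∷ p201 ∷ p021 ∷ [])
  ∷ cert (3F ∷ 0F ∷ 1F ∷ 4F ∷ 2F ∷ []) (1F ∷ 2F ∷ 4F ∷ 0F ∷ 3F ∷ []) (p021 ∷ p102 ∷ p210 ∷ p120 ∷ p021 ∷ [])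
  ∷ cert (1F ∷ 0F ∷ 4F ∷ 2F ∷ 3F ∷ []) (1F ∷ 0F ∷ 3F ∷ 4F ∷ 2F ∷ []) (p120 ∷ p120 ∷ p021 ∷ p012 ∷ p201 ∷ [])
  ∷ cert (2F ∷ 1F ∷ 3F ∷ 0F ∷ 4F ∷ []) (3F ∷ 1F ∷ 0F ∷ 2F ∷ 4F ∷ []) (p012 ∷ p120 ∷ p021 ∷ p210 ∷ p201 ∷ [])
  ∷ cert (2F ∷ 1F ∷ 3F ∷ 0F ∷ 4F ∷ []) (3F ∷ 1F ∷ 0F ∷ 2F ∷ 4F ∷ []) (p102 ∷ p210 ∷ p120 ∷ p201 ∷ p102 ∷ [])
  ∷ cert (2F ∷ 1F ∷ 3F ∷ 0F ∷ 4F ∷ []) (3F ∷ 1F ∷ 0F ∷ 2F ∷ 4F ∷ []) (p102 ∷ p201 ∷ p210 ∷ p021 ∷ p201 ∷ [])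
  ∷ cert (2F ∷ 1F ∷ 3F ∷ 4F ∷ 0F ∷ []) (4F ∷ 1F ∷ 0F ∷ 2F ∷ 3F ∷ []) (p012 ∷ p210 ∷ p102 ∷ p201 ∷ p102 ∷ [])
  ∷ cert (2F ∷ 1F ∷ 3F ∷ 4F ∷ 0F ∷ []) (4F ∷ 1F ∷ 0F ∷ 2F ∷ 3F ∷ []) (p012 ∷ p012 ∷ p201 ∷ p210 ∷ p012 ∷ [])
  ∷ cert (2F ∷ 1F ∷ 3F ∷ 0F ∷ 4F ∷ []) (3F ∷ 1F ∷ 0F ∷ 2F ∷ 4F ∷ []) (p012 ∷ p012 ∷ p102 ∷ p102 ∷ p201 ∷ [])
  ∷ cert (2F ∷ 1F ∷ 3F ∷ 4F ∷ 0F ∷ []) (4F ∷ 1F ∷ 0F ∷ 2F ∷ 3F ∷ []) (p012 ∷ p120 ∷ p120 ∷ p021 ∷ p012 ∷ [])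
  ∷ cert (2F ∷ 1F ∷ 0F ∷ 3F ∷ 4F ∷ []) (2F ∷ 1F ∷ 0F ∷ 3F ∷ 4F ∷ []) (p012 ∷ p102 ∷ p021 ∷ p210 ∷ p201 ∷ [])
  ∷ cert (2F ∷ 1F ∷ 3F ∷ 4F ∷ 0F ∷ []) (4F ∷ 1F ∷ 0F ∷ 2F ∷ 3F ∷ []) (p102 ∷ p210 ∷ p021 ∷ p120 ∷ p021 ∷ [])
  ∷ cert (2F ∷ 1F ∷ 3F ∷ 4F ∷ 0F ∷ []) (4F ∷ 1F ∷ 0F ∷ 2F ∷ 3F ∷ []) (p012 ∷ p021 ∷ p021 ∷ p012 ∷ p102 ∷ [])
  ∷ cert (3F ∷ 0F ∷ 1F ∷ 2F ∷ 4F ∷ []) (1F ∷ 2F ∷ 3F ∷ 0F ∷ 4F ∷ []) (p120 ∷ p102 ∷ p012 ∷ p012 ∷ p210 ∷ [])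
  ∷ cert (1F ∷ 0F ∷ 4F ∷ 3F ∷ 2F ∷ []) (1F ∷ 0F ∷ 4F ∷ 3F ∷ 2F ∷ []) (p120 ∷ p021 ∷ p021 ∷ p012 ∷ p201 ∷ [])
  ∷ cert (1F ∷ 0F ∷ 4F ∷ 3F ∷ 2F ∷ []) (1F ∷ 0F ∷ 4F ∷ 3F ∷ 2F ∷ []) (p021 ∷ p120 ∷ p201 ∷ p102 ∷ p021 ∷ [])
  ∷ cert (2F ∷ 1F ∷ 3F ∷ 4F ∷ 0F ∷ []) (4F ∷ 1F ∷ 0F ∷ 2F ∷ 3F ∷ []) (p102 ∷ p120 ∷ p201 ∷ p102 ∷ p120 ∷ [])
  ∷ cert (2F ∷ 0F ∷ 1F ∷ 3F ∷ 4F ∷ []) (1F ∷ 2F ∷ 0F ∷ 3F ∷ 4F ∷ []) (p012 ∷ p120 ∷ p012 ∷ p210 ∷ p210 ∷ [])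
  ∷ cert (2F ∷ 1F ∷ 0F ∷ 3F ∷ 4F ∷ []) (2F ∷ 1F ∷ 0F ∷ 3F ∷ 4F ∷ []) (p102 ∷ p201 ∷ p012 ∷ p120 ∷ p021 ∷ [])
  ∷ cert (2F ∷ 0F ∷ 1F ∷ 3F ∷ 4F ∷ []) (1F ∷ 2F ∷ 0F ∷ 3F ∷ 4F ∷ []) (p102 ∷ p102 ∷ p210 ∷ p120 ∷ p120 ∷ [])
  ∷ cert (2F ∷ 0F ∷ 1F ∷ 3F ∷ 4F ∷ []) (1F ∷ 2F ∷ 0F ∷ 3F ∷ 4F ∷ []) (p012 ∷ p210 ∷ p021 ∷ p120 ∷ p012 ∷ [])
  ∷ cert (2F ∷ 0F ∷ 1F ∷ 3F ∷ 4F ∷ []) (1F ∷ 2F ∷ 0F ∷ 3F ∷ 4F ∷ []) (p012 ∷ p012 ∷ p201 ∷ p210 ∷ p021 ∷ [])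
  ∷ cert (2F ∷ 0F ∷ 1F ∷ 3F ∷ 4F ∷ []) (1F ∷ 2F ∷ 0F ∷ 3F ∷ 4F ∷ []) (p012 ∷ p102 ∷ p102 ∷ p012 ∷ p012 ∷ [])
  ∷ cert (2F ∷ 1F ∷ 3F ∷ 4F ∷ 0F ∷ []) (4F ∷ 1F ∷ 0F ∷ 2F ∷ 3F ∷ []) (p012 ∷ p210 ∷ p210 ∷ p012 ∷ p210 ∷ [])
  ∷ cert (2F ∷ 1F ∷ 3F ∷ 4F ∷ 0F ∷ []) (4F ∷ 1F ∷ 0F ∷ 2F ∷ 3F ∷ []) (p012 ∷ p201 ∷ p120 ∷ p210 ∷ p120 ∷ [])
  ∷ cert (2F ∷ 0F ∷ 1F ∷ 3F ∷ 4F ∷ []) (1F ∷ 2F ∷ 0F ∷ 3F ∷ 4F ∷ []) (p012 ∷ p012 ∷ p012 ∷ p021 ∷ p102 ∷ [])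
  ∷ cert (2F ∷ 0F ∷ 1F ∷ 3F ∷ 4F ∷ []) (1F ∷ 2F ∷ 0F ∷ 3F ∷ 4F ∷ []) (p102 ∷ p021 ∷ p102 ∷ p120 ∷ p201 ∷ [])
  ∷ cert (2F ∷ 1F ∷ 3F ∷ 0F ∷ 4F ∷ []) (3F ∷ 1F ∷ 0F ∷ 2F ∷ 4F ∷ []) (p012 ∷ p210 ∷ p012 ∷ p120 ∷ p021 ∷ [])
  ∷ cert (2F ∷ 1F ∷ 3F ∷ 4F ∷ 0F ∷ []) (4F ∷ 1F ∷ 0F ∷ 2F ∷ 3F ∷ []) (p102 ∷ p102 ∷ p210 ∷ p120 ∷ p102 ∷ [])
  ∷ cert (3F ∷ 0F ∷ 2F ∷ 1F ∷ 4F ∷ []) (1F ∷ 3F ∷ 2F ∷ 0F ∷ 4F ∷ []) (p021 ∷ p012 ∷ p201 ∷ p120 ∷ p210 ∷ [])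
  ∷ cert (1F ∷ 0F ∷ 3F ∷ 4F ∷ 2F ∷ []) (1F ∷ 0F ∷ 4F ∷ 2F ∷ 3F ∷ []) (p021 ∷ p120 ∷ p201 ∷ p102 ∷ p201 ∷ [])
  ∷ cert (1F ∷ 0F ∷ 3F ∷ 4F ∷ 2F ∷ []) (1F ∷ 0F ∷ 4F ∷ 2F ∷ 3F ∷ []) (p120 ∷ p021 ∷ p021 ∷ p012 ∷ p021 ∷ [])
  ∷ cert (2F ∷ 1F ∷ 3F ∷ 4F ∷ 0F ∷ []) (4F ∷ 1F ∷ 0F ∷ 2F ∷ 3F ∷ []) (p012 ∷ p012 ∷ p012 ∷ p021 ∷ p120 ∷ [])
  ∷ cert (2F ∷ 0F ∷ 1F ∷ 3F ∷ 4F ∷ []) (1F ∷ 2F ∷ 0F ∷ 3F ∷ 4F ∷ []) (p012 ∷ p012 ∷ p120 ∷ p102 ∷ p210 ∷ [])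
  ∷ cert (2F ∷ 0F ∷ 1F ∷ 3F ∷ 4F ∷ []) (1F ∷ 2F ∷ 0F ∷ 3F ∷ 4F ∷ []) (p102 ∷ p021 ∷ p021 ∷ p012 ∷ p120 ∷ [])
  ∷ cert (2F ∷ 1F ∷ 0F ∷ 3F ∷ 4F ∷ []) (2F ∷ 1F ∷ 0F ∷ 3F ∷ 4F ∷ []) (p012 ∷ p210 ∷ p021 ∷ p102 ∷ p012 ∷ [])
  ∷ cert (1F ∷ 0F ∷ 4F ∷ 3F ∷ 2F ∷ []) (1F ∷ 0F ∷ 4F ∷ 3F ∷ 2F ∷ []) (p120 ∷ p021 ∷ p102 ∷ p120 ∷ p012 ∷ [])
  ∷ cert (1F ∷ 0F ∷ 4F ∷ 3F ∷ 2F ∷ []) (1F ∷ 0F ∷ 4F ∷ 3F ∷ 2F ∷ []) (p021 ∷ p120 ∷ p012 ∷ p210 ∷ p102 ∷ [])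
  ∷ cert (3F ∷ 0F ∷ 1F ∷ 2F ∷ 4F ∷ []) (1F ∷ 2F ∷ 3F ∷ 0F ∷ 4F ∷ []) (p021 ∷ p012 ∷ p021 ∷ p210 ∷ p120 ∷ [])
  ∷ cert (2F ∷ 1F ∷ 3F ∷ 4F ∷ 0F ∷ []) (4F ∷ 1F ∷ 0F ∷ 2F ∷ 3F ∷ []) (p102 ∷ p120 ∷ p012 ∷ p210 ∷ p201 ∷ [])
  ∷ cert (2F ∷ 1F ∷ 3F ∷ 4F ∷ 0F ∷ []) (4F ∷ 1F ∷ 0F ∷ 2F ∷ 3F ∷ []) (p012 ∷ p021 ∷ p102 ∷ p120 ∷ p210 ∷ [])
  ∷ cert (2F ∷ 0F ∷ 1F ∷ 3F ∷ 4F ∷ []) (1F ∷ 2F ∷ 0F ∷ 3F ∷ 4F ∷ []) (p102 ∷ p021 ∷ p210 ∷ p201 ∷ p012 ∷ [])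
  ∷ cert (3F ∷ 4F ∷ 0F ∷ 1F ∷ 2F ∷ []) (2F ∷ 3F ∷ 4F ∷ 0F ∷ 1F ∷ []) (p021 ∷ p120 ∷ p012 ∷ p201 ∷ p102 ∷ [])
  ∷ cert (0F ∷ 2F ∷ 1F ∷ 3F ∷ 4F ∷ []) (0F ∷ 2F ∷ 1F ∷ 3F ∷ 4F ∷ []) (p210 ∷ p012 ∷ p012 ∷ p102 ∷ p021 ∷ [])
  ∷ cert (1F ∷ 2F ∷ 0F ∷ 3F ∷ 4F ∷ []) (2F ∷ 0F ∷ 1F ∷ 3F ∷ 4F ∷ []) (p120 ∷ p012 ∷ p012 ∷ p102 ∷ p021 ∷ [])
  ∷ cert (1F ∷ 2F ∷ 0F ∷ 4F ∷ 3F ∷ []) (2F ∷ 0F ∷ 1F ∷ 4F ∷ 3F ∷ []) (p120 ∷ p012 ∷ p021 ∷ p120 ∷ p012 ∷ [])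
  ∷ cert (2F ∷ 0F ∷ 1F ∷ 3F ∷ 4F ∷ []) (1F ∷ 2F ∷ 0F ∷ 3F ∷ 4F ∷ []) (p012 ∷ p210 ∷ p021 ∷ p120 ∷ p012 ∷ [])
  ∷ cert (3F ∷ 4F ∷ 0F ∷ 2F ∷ 1F ∷ []) (2F ∷ 4F ∷ 3F ∷ 0F ∷ 1F ∷ []) (p021 ∷ p120 ∷ p021 ∷ p012 ∷ p210 ∷ [])
  ∷ cert (1F ∷ 2F ∷ 0F ∷ 4F ∷ 3F ∷ []) (2F ∷ 0F ∷ 1F ∷ 4F ∷ 3F ∷ []) (p021 ∷ p102 ∷ p120 ∷ p210 ∷ p102 ∷ [])
  ∷ cert (2F ∷ 0F ∷ 1F ∷ 3F ∷ 4F ∷ []) (1F ∷ 2F ∷ 0F ∷ 3F ∷ 4F ∷ []) (p102 ∷ p201 ∷ p120 ∷ p210 ∷ p102 ∷ [])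
  ∷ cert (1F ∷ 2F ∷ 0F ∷ 3F ∷ 4F ∷ []) (2F ∷ 0F ∷ 1F ∷ 3F ∷ 4F ∷ []) (p021 ∷ p102 ∷ p210 ∷ p012 ∷ p201 ∷ [])
  ∷ cert (2F ∷ 0F ∷ 1F ∷ 3F ∷ 4F ∷ []) (1F ∷ 2F ∷ 0F ∷ 3F ∷ 4F ∷ []) (p102 ∷ p201 ∷ p201 ∷ p021 ∷ p210 ∷ [])
  ∷ cert (2F ∷ 1F ∷ 3F ∷ 0F ∷ 4F ∷ []) (3F ∷ 1F ∷ 0F ∷ 2F ∷ 4F ∷ []) (p102 ∷ p120 ∷ p210 ∷ p102 ∷ p120 ∷ [])
  ∷ cert (2F ∷ 1F ∷ 0F ∷ 3F ∷ 4F ∷ []) (2F ∷ 1F ∷ 0F ∷ 3F ∷ 4F ∷ []) (p102 ∷ p120 ∷ p012 ∷ p201 ∷ p210 ∷ [])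
  ∷ cert (2F ∷ 0F ∷ 1F ∷ 3F ∷ 4F ∷ []) (1F ∷ 2F ∷ 0F ∷ 3F ∷ 4F ∷ []) (p012 ∷ p102 ∷ p021 ∷ p201 ∷ p201 ∷ [])
  ∷ cert (2F ∷ 1F ∷ 3F ∷ 0F ∷ 4F ∷ []) (3F ∷ 1F ∷ 0F ∷ 2F ∷ 4F ∷ []) (p012 ∷ p201 ∷ p021 ∷ p102 ∷ p012 ∷ [])
  ∷ cert (2F ∷ 0F ∷ 1F ∷ 3F ∷ 4F ∷ []) (1F ∷ 2F ∷ 0F ∷ 3F ∷ 4F ∷ []) (p102 ∷ p120 ∷ p201 ∷ p102 ∷ p102 ∷ [])
  ∷ cert (1F ∷ 0F ∷ 3F ∷ 4F ∷ 2F ∷ []) (1F ∷ 0F ∷ 4F ∷ 2F ∷ 3F ∷ []) (p120 ∷ p120 ∷ p012 ∷ p210 ∷ p012 ∷ [])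
  ∷ cert (1F ∷ 0F ∷ 3F ∷ 4F ∷ 2F ∷ []) (1F ∷ 0F ∷ 4F ∷ 2F ∷ 3F ∷ []) (p021 ∷ p021 ∷ p102 ∷ p120 ∷ p102 ∷ [])
  ∷ cert (3F ∷ 0F ∷ 2F ∷ 1F ∷ 4F ∷ []) (1F ∷ 3F ∷ 2F ∷ 0F ∷ 4F ∷ []) (p021 ∷ p102 ∷ p102 ∷ p102 ∷ p120 ∷ [])
  ∷ cert (2F ∷ 1F ∷ 3F ∷ 4F ∷ 0F ∷ []) (4F ∷ 1F ∷ 0F ∷ 2F ∷ 3F ∷ []) (p102 ∷ p012 ∷ p120 ∷ p102 ∷ p201 ∷ [])
  ∷ cert (2F ∷ 1F ∷ 3F ∷ 4F ∷ 0F ∷ []) (4F ∷ 1F ∷ 0F ∷ 2F ∷ 3F ∷ []) (p012 ∷ p102 ∷ p021 ∷ p201 ∷ p210 ∷ [])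
  ∷ cert (2F ∷ 1F ∷ 0F ∷ 3F ∷ 4F ∷ []) (2F ∷ 1F ∷ 0F ∷ 3F ∷ 4F ∷ []) (p012 ∷ p210 ∷ p210 ∷ p021 ∷ p201 ∷ [])
  ∷ cert (2F ∷ 1F ∷ 0F ∷ 3F ∷ 4F ∷ []) (2F ∷ 1F ∷ 0F ∷ 3F ∷ 4F ∷ []) (p012 ∷ p201 ∷ p120 ∷ p201 ∷ p102 ∷ [])
  ∷ cert (3F ∷ 0F ∷ 4F ∷ 1F ∷ 2F ∷ []) (1F ∷ 3F ∷ 4F ∷ 0F ∷ 2F ∷ []) (p120 ∷ p102 ∷ p021 ∷ p201 ∷ p012 ∷ [])
  ∷ cert (1F ∷ 0F ∷ 2F ∷ 4F ∷ 3F ∷ []) (1F ∷ 0F ∷ 2F ∷ 4F ∷ 3F ∷ []) (p120 ∷ p021 ∷ p012 ∷ p210 ∷ p012 ∷ [])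
  ∷ cert (2F ∷ 1F ∷ 0F ∷ 3F ∷ 4F ∷ []) (2F ∷ 1F ∷ 0F ∷ 3F ∷ 4F ∷ []) (p012 ∷ p021 ∷ p210 ∷ p210 ∷ p012 ∷ [])
  ∷ cert (1F ∷ 0F ∷ 2F ∷ 4F ∷ 3F ∷ []) (1F ∷ 0F ∷ 2F ∷ 4F ∷ 3F ∷ []) (p021 ∷ p120 ∷ p102 ∷ p120 ∷ p102 ∷ [])
  ∷ cert (2F ∷ 1F ∷ 0F ∷ 3F ∷ 4F ∷ []) (2F ∷ 1F ∷ 0F ∷ 3F ∷ 4F ∷ []) (p102 ∷ p120 ∷ p201 ∷ p120 ∷ p102 ∷ [])
  ∷ cert (1F ∷ 0F ∷ 2F ∷ 4F ∷ 3F ∷ []) (1F ∷ 0F ∷ 2F ∷ 4F ∷ 3F ∷ []) (p120 ∷ p120 ∷ p021 ∷ p012 ∷ p021 ∷ [])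
  ∷ cert (2F ∷ 1F ∷ 0F ∷ 3F ∷ 4F ∷ []) (2F ∷ 1F ∷ 0F ∷ 3F ∷ 4F ∷ []) (p012 ∷ p120 ∷ p120 ∷ p012 ∷ p021 ∷ [])
  ∷ cert (3F ∷ 0F ∷ 4F ∷ 1F ∷ 2F ∷ []) (1F ∷ 3F ∷ 4F ∷ 0F ∷ 2F ∷ []) (p021 ∷ p102 ∷ p210 ∷ p120 ∷ p201 ∷ [])
  ∷ cert (2F ∷ 1F ∷ 0F ∷ 3F ∷ 4F ∷ []) (2F ∷ 1F ∷ 0F ∷ 3F ∷ 4F ∷ []) (p102 ∷ p021 ∷ p102 ∷ p102 ∷ p201 ∷ [])
  ∷ cert (1F ∷ 0F ∷ 2F ∷ 4F ∷ 3F ∷ []) (1F ∷ 0F ∷ 2F ∷ 4F ∷ 3F ∷ []) (p021 ∷ p021 ∷ p201 ∷ p102 ∷ p201 ∷ [])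
  ∷ cert (2F ∷ 1F ∷ 3F ∷ 4F ∷ 0F ∷ []) (4F ∷ 1F ∷ 0F ∷ 2F ∷ 3F ∷ []) (p012 ∷ p201 ∷ p012 ∷ p102 ∷ p012 ∷ [])
  ∷ cert (2F ∷ 1F ∷ 3F ∷ 4F ∷ 0F ∷ []) (4F ∷ 1F ∷ 0F ∷ 2F ∷ 3F ∷ []) (p102 ∷ p102 ∷ p102 ∷ p012 ∷ p021 ∷ [])
  ∷ cert (2F ∷ 1F ∷ 3F ∷ 0F ∷ 4F ∷ []) (3F ∷ 1F ∷ 0F ∷ 2F ∷ 4F ∷ []) (p102 ∷ p102 ∷ p201 ∷ p120 ∷ p102 ∷ [])
  ∷ cert (2F ∷ 1F ∷ 0F ∷ 3F ∷ 4F ∷ []) (2F ∷ 1F ∷ 0F ∷ 3F ∷ 4F ∷ []) (p102 ∷ p012 ∷ p012 ∷ p012 ∷ p102 ∷ [])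
  ∷ cert (2F ∷ 1F ∷ 3F ∷ 4F ∷ 0F ∷ []) (4F ∷ 1F ∷ 0F ∷ 2F ∷ 3F ∷ []) (p102 ∷ p021 ∷ p210 ∷ p201 ∷ p021 ∷ [])
  ∷ cert (2F ∷ 1F ∷ 3F ∷ 4F ∷ 0F ∷ []) (4F ∷ 1F ∷ 0F ∷ 2F ∷ 3F ∷ []) (p102 ∷ p201 ∷ p201 ∷ p021 ∷ p201 ∷ [])
  ∷ cert (2F ∷ 1F ∷ 0F ∷ 3F ∷ 4F ∷ []) (2F ∷ 1F ∷ 0F ∷ 3F ∷ 4F ∷ []) (p102 ∷ p102 ∷ p102 ∷ p021 ∷ p012 ∷ [])
  ∷ cert (1F ∷ 0F ∷ 2F ∷ 3F ∷ 4F ∷ []) (1F ∷ 0F ∷ 2F ∷ 3F ∷ 4F ∷ []) (p021 ∷ p120 ∷ p201 ∷ p012 ∷ p021 ∷ [])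
  ∷ cert (3F ∷ 0F ∷ 4F ∷ 2F ∷ 1F ∷ []) (1F ∷ 4F ∷ 3F ∷ 0F ∷ 2F ∷ []) (p120 ∷ p102 ∷ p012 ∷ p102 ∷ p210 ∷ [])
  ∷ cert (1F ∷ 0F ∷ 2F ∷ 3F ∷ 4F ∷ []) (1F ∷ 0F ∷ 2F ∷ 3F ∷ 4F ∷ []) (p120 ∷ p021 ∷ p021 ∷ p102 ∷ p201 ∷ [])
  ∷ cert (2F ∷ 1F ∷ 0F ∷ 3F ∷ 4F ∷ []) (2F ∷ 1F ∷ 0F ∷ 3F ∷ 4F ∷ []) (p012 ∷ p012 ∷ p120 ∷ p120 ∷ p210 ∷ [])
  ∷ cert (2F ∷ 1F ∷ 0F ∷ 3F ∷ 4F ∷ []) (2F ∷ 1F ∷ 0F ∷ 3F ∷ 4F ∷ []) (p102 ∷ p210 ∷ p102 ∷ p210 ∷ p120 ∷ [])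
  ∷ cert (2F ∷ 0F ∷ 1F ∷ 3F ∷ 4F ∷ []) (1F ∷ 2F ∷ 0F ∷ 3F ∷ 4F ∷ []) (p102 ∷ p120 ∷ p201 ∷ p102 ∷ p102 ∷ [])
  ∷ cert (2F ∷ 0F ∷ 1F ∷ 3F ∷ 4F ∷ []) (1F ∷ 2F ∷ 0F ∷ 3F ∷ 4F ∷ []) (p012 ∷ p120 ∷ p201 ∷ p102 ∷ p102 ∷ [])
  ∷ cert (2F ∷ 1F ∷ 0F ∷ 3F ∷ 4F ∷ []) (2F ∷ 1F ∷ 0F ∷ 3F ∷ 4F ∷ []) (p012 ∷ p210 ∷ p102 ∷ p210 ∷ p120 ∷ [])
  ∷ cert (2F ∷ 1F ∷ 0F ∷ 3F ∷ 4F ∷ []) (2F ∷ 1F ∷ 0F ∷ 3F ∷ 4F ∷ []) (p012 ∷ p102 ∷ p102 ∷ p021 ∷ p012 ∷ [])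
  ∷ cert (1F ∷ 0F ∷ 2F ∷ 3F ∷ 4F ∷ []) (1F ∷ 0F ∷ 2F ∷ 3F ∷ 4F ∷ []) (p120 ∷ p120 ∷ p201 ∷ p012 ∷ p021 ∷ [])
  ∷ cert (3F ∷ 0F ∷ 4F ∷ 2F ∷ 1F ∷ []) (1F ∷ 4F ∷ 3F ∷ 0F ∷ 2F ∷ []) (p021 ∷ p102 ∷ p012 ∷ p102 ∷ p210 ∷ [])
  ∷ cert (1F ∷ 0F ∷ 2F ∷ 3F ∷ 4F ∷ []) (1F ∷ 0F ∷ 2F ∷ 3F ∷ 4F ∷ []) (p021 ∷ p021 ∷ p021 ∷ p102 ∷ p201 ∷ [])
  ∷ cert (2F ∷ 1F ∷ 0F ∷ 3F ∷ 4F ∷ []) (2F ∷ 1F ∷ 0F ∷ 3F ∷ 4F ∷ []) (p102 ∷ p012 ∷ p120 ∷ p120 ∷ p210 ∷ [])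
  ∷ cert (2F ∷ 1F ∷ 3F ∷ 4F ∷ 0F ∷ []) (4F ∷ 1F ∷ 0F ∷ 2F ∷ 3F ∷ []) (p012 ∷ p201 ∷ p201 ∷ p021 ∷ p201 ∷ [])
  ∷ cert (2F ∷ 1F ∷ 0F ∷ 3F ∷ 4F ∷ []) (2F ∷ 1F ∷ 0F ∷ 3F ∷ 4F ∷ []) (p012 ∷ p012 ∷ p012 ∷ p012 ∷ p102 ∷ [])
  ∷ cert (2F ∷ 1F ∷ 3F ∷ 4F ∷ 0F ∷ []) (4F ∷ 1F ∷ 0F ∷ 2F ∷ 3F ∷ []) (p012 ∷ p021 ∷ p210 ∷ p201 ∷ p021 ∷ [])
  ∷ cert (2F ∷ 1F ∷ 3F ∷ 0F ∷ 4F ∷ []) (3F ∷ 1F ∷ 0F ∷ 2F ∷ 4F ∷ []) (p012 ∷ p102 ∷ p201 ∷ p120 ∷ p102 ∷ [])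
  ∷ cert (2F ∷ 1F ∷ 3F ∷ 4F ∷ 0F ∷ []) (4F ∷ 1F ∷ 0F ∷ 2F ∷ 3F ∷ []) (p012 ∷ p102 ∷ p102 ∷ p012 ∷ p021 ∷ [])
  ∷ cert (2F ∷ 1F ∷ 3F ∷ 4F ∷ 0F ∷ []) (4F ∷ 1F ∷ 0F ∷ 2F ∷ 3F ∷ []) (p102 ∷ p201 ∷ p012 ∷ p102 ∷ p012 ∷ [])
  ∷ cert (1F ∷ 0F ∷ 2F ∷ 4F ∷ 3F ∷ []) (1F ∷ 0F ∷ 2F ∷ 4F ∷ 3F ∷ []) (p021 ∷ p120 ∷ p021 ∷ p012 ∷ p021 ∷ [])
  ∷ cert (2F ∷ 1F ∷ 0F ∷ 3F ∷ 4F ∷ []) (2F ∷ 1F ∷ 0F ∷ 3F ∷ 4F ∷ []) (p102 ∷ p120 ∷ p120 ∷ p012 ∷ p021 ∷ [])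
  ∷ cert (3F ∷ 0F ∷ 4F ∷ 1F ∷ 2F ∷ []) (1F ∷ 3F ∷ 4F ∷ 0F ∷ 2F ∷ []) (p120 ∷ p102 ∷ p210 ∷ p120 ∷ p201 ∷ [])
  ∷ cert (2F ∷ 1F ∷ 0F ∷ 3F ∷ 4F ∷ []) (2F ∷ 1F ∷ 0F ∷ 3F ∷ 4F ∷ []) (p012 ∷ p021 ∷ p102 ∷ p102 ∷ p201 ∷ [])
  ∷ cert (1F ∷ 0F ∷ 2F ∷ 4F ∷ 3F ∷ []) (1F ∷ 0F ∷ 2F ∷ 4F ∷ 3F ∷ []) (p120 ∷ p021 ∷ p201 ∷ p102 ∷ p201 ∷ [])
  ∷ cert (3F ∷ 0F ∷ 4F ∷ 1F ∷ 2F ∷ []) (1F ∷ 3F ∷ 4F ∷ 0F ∷ 2F ∷ []) (p021 ∷ p102 ∷ p021 ∷ p201 ∷ p012 ∷ [])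
  ∷ cert (1F ∷ 0F ∷ 2F ∷ 4F ∷ 3F ∷ []) (1F ∷ 0F ∷ 2F ∷ 4F ∷ 3F ∷ []) (p021 ∷ p021 ∷ p012 ∷ p210 ∷ p012 ∷ [])
  ∷ cert (2F ∷ 1F ∷ 0F ∷ 3F ∷ 4F ∷ []) (2F ∷ 1F ∷ 0F ∷ 3F ∷ 4F ∷ []) (p102 ∷ p021 ∷ p210 ∷ p210 ∷ p012 ∷ [])
  ∷ cert (1F ∷ 0F ∷ 2F ∷ 4F ∷ 3F ∷ []) (1F ∷ 0F ∷ 2F ∷ 4F ∷ 3F ∷ []) (p120 ∷ p120 ∷ p102 ∷ p120 ∷ p102 ∷ [])
  ∷ cert (2F ∷ 1F ∷ 0F ∷ 3F ∷ 4F ∷ []) (2F ∷ 1F ∷ 0F ∷ 3F ∷ 4F ∷ []) (p012 ∷ p120 ∷ p201 ∷ p120 ∷ p102 ∷ [])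
  ∷ cert (2F ∷ 1F ∷ 0F ∷ 3F ∷ 4F ∷ []) (2F ∷ 1F ∷ 0F ∷ 3F ∷ 4F ∷ []) (p102 ∷ p201 ∷ p120 ∷ p201 ∷ p102 ∷ [])
  ∷ cert (2F ∷ 1F ∷ 0F ∷ 3F ∷ 4F ∷ []) (2F ∷ 1F ∷ 0F ∷ 3F ∷ 4F ∷ []) (p102 ∷ p210 ∷ p210 ∷ p021 ∷ p201 ∷ [])
  ∷ cert (1F ∷ 0F ∷ 3F ∷ 4F ∷ 2F ∷ []) (1F ∷ 0F ∷ 4F ∷ 2F ∷ 3F ∷ []) (p021 ∷ p120 ∷ p012 ∷ p210 ∷ p012 ∷ [])
  ∷ cert (1F ∷ 0F ∷ 3F ∷ 4F ∷ 2F ∷ []) (1F ∷ 0F ∷ 4F ∷ 2F ∷ 3F ∷ []) (p120 ∷ p021 ∷ p102 ∷ p120 ∷ p102 ∷ [])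
  ∷ cert (3F ∷ 0F ∷ 2F ∷ 1F ∷ 4F ∷ []) (1F ∷ 3F ∷ 2F ∷ 0F ∷ 4F ∷ []) (p120 ∷ p102 ∷ p102 ∷ p102 ∷ p120 ∷ [])
  ∷ cert (2F ∷ 1F ∷ 3F ∷ 4F ∷ 0F ∷ []) (4F ∷ 1F ∷ 0F ∷ 2F ∷ 3F ∷ []) (p012 ∷ p012 ∷ p120 ∷ p102 ∷ p201 ∷ [])
  ∷ cert (2F ∷ 1F ∷ 3F ∷ 4F ∷ 0F ∷ []) (4F ∷ 1F ∷ 0F ∷ 2F ∷ 3F ∷ []) (p102 ∷ p102 ∷ p021 ∷ p201 ∷ p210 ∷ [])
  ∷ cert (2F ∷ 0F ∷ 1F ∷ 3F ∷ 4F ∷ []) (1F ∷ 2F ∷ 0F ∷ 3F ∷ 4F ∷ []) (p012 ∷ p120 ∷ p201 ∷ p102 ∷ p102 ∷ [])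
  ∷ cert (2F ∷ 1F ∷ 3F ∷ 0F ∷ 4F ∷ []) (3F ∷ 1F ∷ 0F ∷ 2F ∷ 4F ∷ []) (p102 ∷ p201 ∷ p021 ∷ p102 ∷ p012 ∷ [])
  ∷ cert (2F ∷ 0F ∷ 1F ∷ 3F ∷ 4F ∷ []) (1F ∷ 2F ∷ 0F ∷ 3F ∷ 4F ∷ []) (p102 ∷ p102 ∷ p021 ∷ p201 ∷ p201 ∷ [])
  ∷ cert (2F ∷ 1F ∷ 3F ∷ 0F ∷ 4F ∷ []) (3F ∷ 1F ∷ 0F ∷ 2F ∷ 4F ∷ []) (p012 ∷ p120 ∷ p210 ∷ p102 ∷ p120 ∷ [])
  ∷ cert (2F ∷ 1F ∷ 0F ∷ 3F ∷ 4F ∷ []) (2F ∷ 1F ∷ 0F ∷ 3F ∷ 4F ∷ []) (p012 ∷ p120 ∷ p012 ∷ p201 ∷ p210 ∷ [])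
  ∷ cert (3F ∷ 4F ∷ 0F ∷ 1F ∷ 2F ∷ []) (2F ∷ 3F ∷ 4F ∷ 0F ∷ 1F ∷ []) (p120 ∷ p120 ∷ p012 ∷ p201 ∷ p102 ∷ [])
  ∷ cert (0F ∷ 2F ∷ 1F ∷ 3F ∷ 4F ∷ []) (0F ∷ 2F ∷ 1F ∷ 3F ∷ 4F ∷ []) (p201 ∷ p012 ∷ p012 ∷ p102 ∷ p021 ∷ [])
  ∷ cert (1F ∷ 2F ∷ 0F ∷ 3F ∷ 4F ∷ []) (2F ∷ 0F ∷ 1F ∷ 3F ∷ 4F ∷ []) (p021 ∷ p012 ∷ p012 ∷ p102 ∷ p021 ∷ [])
  ∷ cert (1F ∷ 2F ∷ 0F ∷ 4F ∷ 3F ∷ []) (2F ∷ 0F ∷ 1F ∷ 4F ∷ 3F ∷ []) (p021 ∷ p012 ∷ p021 ∷ p120 ∷ p012 ∷ [])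
  ∷ cert (2F ∷ 0F ∷ 1F ∷ 3F ∷ 4F ∷ []) (1F ∷ 2F ∷ 0F ∷ 3F ∷ 4F ∷ []) (p102 ∷ p210 ∷ p021 ∷ p120 ∷ p012 ∷ [])
  ∷ cert (3F ∷ 4F ∷ 0F ∷ 2F ∷ 1F ∷ []) (2F ∷ 4F ∷ 3F ∷ 0F ∷ 1F ∷ []) (p120 ∷ p120 ∷ p021 ∷ p012 ∷ p210 ∷ [])
  ∷ cert (1F ∷ 2F ∷ 0F ∷ 4F ∷ 3F ∷ []) (2F ∷ 0F ∷ 1F ∷ 4F ∷ 3F ∷ []) (p120 ∷ p102 ∷ p120 ∷ p210 ∷ p102 ∷ [])
  ∷ cert (2F ∷ 0F ∷ 1F ∷ 3F ∷ 4F ∷ []) (1F ∷ 2F ∷ 0F ∷ 3F ∷ 4F ∷ []) (p012 ∷ p201 ∷ p120 ∷ p210 ∷ p102 ∷ [])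
  ∷ cert (1F ∷ 2F ∷ 0F ∷ 3F ∷ 4F ∷ []) (2F ∷ 0F ∷ 1F ∷ 3F ∷ 4F ∷ []) (p120 ∷ p102 ∷ p210 ∷ p012 ∷ p201 ∷ [])
  ∷ cert (2F ∷ 0F ∷ 1F ∷ 3F ∷ 4F ∷ []) (1F ∷ 2F ∷ 0F ∷ 3F ∷ 4F ∷ []) (p012 ∷ p201 ∷ p201 ∷ p021 ∷ p210 ∷ [])
  ∷ cert (2F ∷ 0F ∷ 1F ∷ 3F ∷ 4F ∷ []) (1F ∷ 2F ∷ 0F ∷ 3F ∷ 4F ∷ []) (p012 ∷ p021 ∷ p210 ∷ p201 ∷ p012 ∷ [])
  ∷ cert (1F ∷ 0F ∷ 4F ∷ 3F ∷ 2F ∷ []) (1F ∷ 0F ∷ 4F ∷ 3F ∷ 2F ∷ []) (p021 ∷ p021 ∷ p102 ∷ p120 ∷ p012 ∷ [])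
  ∷ cert (1F ∷ 0F ∷ 4F ∷ 3F ∷ 2F ∷ []) (1F ∷ 0F ∷ 4F ∷ 3F ∷ 2F ∷ []) (p120 ∷ p120 ∷ p012 ∷ p210 ∷ p102 ∷ [])
  ∷ cert (3F ∷ 0F ∷ 1F ∷ 2F ∷ 4F ∷ []) (1F ∷ 2F ∷ 3F ∷ 0F ∷ 4F ∷ []) (p120 ∷ p012 ∷ p021 ∷ p210 ∷ p120 ∷ [])
  ∷ cert (2F ∷ 1F ∷ 3F ∷ 4F ∷ 0F ∷ []) (4F ∷ 1F ∷ 0F ∷ 2F ∷ 3F ∷ []) (p012 ∷ p120 ∷ p012 ∷ p210 ∷ p201 ∷ [])
  ∷ cert (2F ∷ 1F ∷ 3F ∷ 4F ∷ 0F ∷ []) (4F ∷ 1F ∷ 0F ∷ 2F ∷ 3F ∷ []) (p102 ∷ p021 ∷ p102 ∷ p120 ∷ p210 ∷ [])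
  ∷ cert (2F ∷ 1F ∷ 0F ∷ 3F ∷ 4F ∷ []) (2F ∷ 1F ∷ 0F ∷ 3F ∷ 4F ∷ []) (p102 ∷ p210 ∷ p021 ∷ p102 ∷ p012 ∷ [])
  ∷ cert (2F ∷ 0F ∷ 1F ∷ 3F ∷ 4F ∷ []) (1F ∷ 2F ∷ 0F ∷ 3F ∷ 4F ∷ []) (p012 ∷ p021 ∷ p021 ∷ p012 ∷ p120 ∷ [])
  ∷ cert (2F ∷ 0F ∷ 1F ∷ 3F ∷ 4F ∷ []) (1F ∷ 2F ∷ 0F ∷ 3F ∷ 4F ∷ []) (p102 ∷ p012 ∷ p120 ∷ p102 ∷ p210 ∷ [])
  ∷ cert (2F ∷ 1F ∷ 3F ∷ 4F ∷ 0F ∷ []) (4F ∷ 1F ∷ 0F ∷ 2F ∷ 3F ∷ []) (p012 ∷ p102 ∷ p210 ∷ p120 ∷ p102 ∷ [])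
  ∷ cert (3F ∷ 0F ∷ 2F ∷ 1F ∷ 4F ∷ []) (1F ∷ 3F ∷ 2F ∷ 0F ∷ 4F ∷ []) (p120 ∷ p012 ∷ p201 ∷ p120 ∷ p210 ∷ [])
  ∷ cert (1F ∷ 0F ∷ 3F ∷ 4F ∷ 2F ∷ []) (1F ∷ 0F ∷ 4F ∷ 2F ∷ 3F ∷ []) (p120 ∷ p120 ∷ p201 ∷ p102 ∷ p201 ∷ [])
  ∷ cert (1F ∷ 0F ∷ 3F ∷ 4F ∷ 2F ∷ []) (1F ∷ 0F ∷ 4F ∷ 2F ∷ 3F ∷ []) (p021 ∷ p021 ∷ p021 ∷ p012 ∷ p021 ∷ [])
  ∷ cert (2F ∷ 1F ∷ 3F ∷ 4F ∷ 0F ∷ []) (4F ∷ 1F ∷ 0F ∷ 2F ∷ 3F ∷ []) (p102 ∷ p012 ∷ p012 ∷ p021 ∷ p120 ∷ [])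
  ∷ cert (2F ∷ 1F ∷ 3F ∷ 0F ∷ 4F ∷ []) (3F ∷ 1F ∷ 0F ∷ 2F ∷ 4F ∷ []) (p102 ∷ p210 ∷ p012 ∷ p120 ∷ p021 ∷ [])
  ∷ cert (2F ∷ 0F ∷ 1F ∷ 3F ∷ 4F ∷ []) (1F ∷ 2F ∷ 0F ∷ 3F ∷ 4F ∷ []) (p012 ∷ p021 ∷ p102 ∷ p120 ∷ p201 ∷ [])
  ∷ cert (2F ∷ 0F ∷ 1F ∷ 3F ∷ 4F ∷ []) (1F ∷ 2F ∷ 0F ∷ 3F ∷ 4F ∷ []) (p102 ∷ p012 ∷ p012 ∷ p021 ∷ p102 ∷ [])
  ∷ cert (2F ∷ 1F ∷ 3F ∷ 4F ∷ 0F ∷ []) (4F ∷ 1F ∷ 0F ∷ 2F ∷ 3F ∷ []) (p102 ∷ p210 ∷ p210 ∷ p012 ∷ p210 ∷ [])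
  ∷ cert (2F ∷ 1F ∷ 3F ∷ 4F ∷ 0F ∷ []) (4F ∷ 1F ∷ 0F ∷ 2F ∷ 3F ∷ []) (p102 ∷ p201 ∷ p120 ∷ p210 ∷ p120 ∷ [])
  ∷ cert (2F ∷ 0F ∷ 1F ∷ 3F ∷ 4F ∷ []) (1F ∷ 2F ∷ 0F ∷ 3F ∷ 4F ∷ []) (p102 ∷ p102 ∷ p102 ∷ p012 ∷ p012 ∷ [])
  ∷ cert (2F ∷ 0F ∷ 1F ∷ 3F ∷ 4F ∷ []) (1F ∷ 2F ∷ 0F ∷ 3F ∷ 4F ∷ []) (p102 ∷ p012 ∷ p201 ∷ p210 ∷ p021 ∷ [])
  ∷ cert (2F ∷ 0F ∷ 1F ∷ 3F ∷ 4F ∷ []) (1F ∷ 2F ∷ 0F ∷ 3F ∷ 4F ∷ []) (p102 ∷ p210 ∷ p021 ∷ p120 ∷ p012 ∷ [])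
  ∷ cert (2F ∷ 0F ∷ 1F ∷ 3F ∷ 4F ∷ []) (1F ∷ 2F ∷ 0F ∷ 3F ∷ 4F ∷ []) (p012 ∷ p102 ∷ p210 ∷ p120 ∷ p120 ∷ [])
  ∷ cert (2F ∷ 1F ∷ 0F ∷ 3F ∷ 4F ∷ []) (2F ∷ 1F ∷ 0F ∷ 3F ∷ 4F ∷ []) (p012 ∷ p201 ∷ p012 ∷ p120 ∷ p021 ∷ [])
  ∷ cert (2F ∷ 0F ∷ 1F ∷ 3F ∷ 4F ∷ []) (1F ∷ 2F ∷ 0F ∷ 3F ∷ 4F ∷ []) (p102 ∷ p120 ∷ p012 ∷ p210 ∷ p210 ∷ [])
  ∷ cert (2F ∷ 1F ∷ 3F ∷ 4F ∷ 0F ∷ []) (4F ∷ 1F ∷ 0F ∷ 2F ∷ 3F ∷ []) (p102 ∷ p021 ∷ p021 ∷ p012 ∷ p102 ∷ [])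
  ∷ cert (3F ∷ 0F ∷ 1F ∷ 2F ∷ 4F ∷ []) (1F ∷ 2F ∷ 3F ∷ 0F ∷ 4F ∷ []) (p021 ∷ p102 ∷ p012 ∷ p012 ∷ p210 ∷ [])
  ∷ cert (1F ∷ 0F ∷ 4F ∷ 3F ∷ 2F ∷ []) (1F ∷ 0F ∷ 4F ∷ 3F ∷ 2F ∷ []) (p021 ∷ p021 ∷ p021 ∷ p012 ∷ p201 ∷ [])
  ∷ cert (1F ∷ 0F ∷ 4F ∷ 3F ∷ 2F ∷ []) (1F ∷ 0F ∷ 4F ∷ 3F ∷ 2F ∷ []) (p120 ∷ p120 ∷ p201 ∷ p102 ∷ p021 ∷ [])
  ∷ cert (2F ∷ 1F ∷ 3F ∷ 4F ∷ 0F ∷ []) (4F ∷ 1F ∷ 0F ∷ 2F ∷ 3F ∷ []) (p012 ∷ p120 ∷ p201 ∷ p102 ∷ p120 ∷ [])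
  ∷ cert (2F ∷ 1F ∷ 3F ∷ 4F ∷ 0F ∷ []) (4F ∷ 1F ∷ 0F ∷ 2F ∷ 3F ∷ []) (p012 ∷ p210 ∷ p021 ∷ p120 ∷ p021 ∷ [])
  ∷ cert (2F ∷ 1F ∷ 3F ∷ 4F ∷ 0F ∷ []) (4F ∷ 1F ∷ 0F ∷ 2F ∷ 3F ∷ []) (p102 ∷ p120 ∷ p120 ∷ p021 ∷ p012 ∷ [])
  ∷ cert (2F ∷ 1F ∷ 0F ∷ 3F ∷ 4F ∷ []) (2F ∷ 1F ∷ 0F ∷ 3F ∷ 4F ∷ []) (p102 ∷ p102 ∷ p021 ∷ p210 ∷ p201 ∷ [])
  ∷ cert (2F ∷ 1F ∷ 3F ∷ 0F ∷ 4F ∷ []) (3F ∷ 1F ∷ 0F ∷ 2F ∷ 4F ∷ []) (p102 ∷ p012 ∷ p102 ∷ p102 ∷ p201 ∷ [])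
  ∷ cert (2F ∷ 1F ∷ 3F ∷ 4F ∷ 0F ∷ []) (4F ∷ 1F ∷ 0F ∷ 2F ∷ 3F ∷ []) (p102 ∷ p012 ∷ p201 ∷ p210 ∷ p012 ∷ [])
  ∷ cert (2F ∷ 1F ∷ 3F ∷ 4F ∷ 0F ∷ []) (4F ∷ 1F ∷ 0F ∷ 2F ∷ 3F ∷ []) (p102 ∷ p210 ∷ p102 ∷ p201 ∷ p102 ∷ [])
  ∷ cert (2F ∷ 1F ∷ 3F ∷ 0F ∷ 4F ∷ []) (3F ∷ 1F ∷ 0F ∷ 2F ∷ 4F ∷ []) (p012 ∷ p210 ∷ p120 ∷ p201 ∷ p102 ∷ [])
  ∷ cert (2F ∷ 1F ∷ 3F ∷ 0F ∷ 4F ∷ []) (3F ∷ 1F ∷ 0F ∷ 2F ∷ 4F ∷ []) (p012 ∷ p201 ∷ p210 ∷ p021 ∷ p201 ∷ [])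
  ∷ cert (1F ∷ 0F ∷ 4F ∷ 2F ∷ 3F ∷ []) (1F ∷ 0F ∷ 3F ∷ 4F ∷ 2F ∷ []) (p120 ∷ p021 ∷ p201 ∷ p102 ∷ p021 ∷ [])
  ∷ cert (2F ∷ 1F ∷ 3F ∷ 0F ∷ 4F ∷ []) (3F ∷ 1F ∷ 0F ∷ 2F ∷ 4F ∷ []) (p012 ∷ p021 ∷ p201 ∷ p201 ∷ p021 ∷ [])
  ∷ cert (3F ∷ 0F ∷ 1F ∷ 4F ∷ 2F ∷ []) (1F ∷ 2F ∷ 4F ∷ 0F ∷ 3F ∷ []) (p120 ∷ p102 ∷ p210 ∷ p120 ∷ p021 ∷ [])
  ∷ cert (1F ∷ 0F ∷ 4F ∷ 2F ∷ 3F ∷ []) (1F ∷ 0F ∷ 3F ∷ 4F ∷ 2F ∷ []) (p021 ∷ p120 ∷ p021 ∷ p012 ∷ p201 ∷ [])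
  ∷ cert (2F ∷ 1F ∷ 3F ∷ 0F ∷ 4F ∷ []) (3F ∷ 1F ∷ 0F ∷ 2F ∷ 4F ∷ []) (p102 ∷ p120 ∷ p021 ∷ p210 ∷ p201 ∷ [])
  ∷ cert (3F ∷ 0F ∷ 1F ∷ 4F ∷ 2F ∷ []) (1F ∷ 2F ∷ 4F ∷ 0F ∷ 3F ∷ []) (p021 ∷ p102 ∷ p021 ∷ p201 ∷ p102 ∷ [])
  ∷ cert (2F ∷ 1F ∷ 3F ∷ 0F ∷ 4F ∷ []) (3F ∷ 1F ∷ 0F ∷ 2F ∷ 4F ∷ []) (p012 ∷ p120 ∷ p102 ∷ p021 ∷ p012 ∷ [])
  ∷ cert (1F ∷ 0F ∷ 4F ∷ 2F ∷ 3F ∷ []) (1F ∷ 0F ∷ 3F ∷ 4F ∷ 2F ∷ []) (p120 ∷ p120 ∷ p102 ∷ p120 ∷ p012 ∷ [])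
  ∷ cert (2F ∷ 1F ∷ 3F ∷ 0F ∷ 4F ∷ []) (3F ∷ 1F ∷ 0F ∷ 2F ∷ 4F ∷ []) (p102 ∷ p021 ∷ p012 ∷ p012 ∷ p102 ∷ [])
  ∷ cert (1F ∷ 0F ∷ 4F ∷ 2F ∷ 3F ∷ []) (1F ∷ 0F ∷ 3F ∷ 4F ∷ 2F ∷ []) (p021 ∷ p021 ∷ p012 ∷ p210 ∷ p102 ∷ [])
  ∷ cert (3F ∷ 0F ∷ 2F ∷ 4F ∷ 1F ∷ []) (1F ∷ 4F ∷ 2F ∷ 0F ∷ 3F ∷ []) (p120 ∷ p102 ∷ p012 ∷ p102 ∷ p120 ∷ [])
  ∷ cert (2F ∷ 1F ∷ 3F ∷ 0F ∷ 4F ∷ []) (3F ∷ 1F ∷ 0F ∷ 2F ∷ 4F ∷ []) (p102 ∷ p102 ∷ p120 ∷ p012 ∷ p021 ∷ [])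
  ∷ cert (1F ∷ 0F ∷ 3F ∷ 2F ∷ 4F ∷ []) (1F ∷ 0F ∷ 3F ∷ 2F ∷ 4F ∷ []) (p021 ∷ p120 ∷ p102 ∷ p210 ∷ p012 ∷ [])
  ∷ cert (2F ∷ 1F ∷ 3F ∷ 0F ∷ 4F ∷ []) (3F ∷ 1F ∷ 0F ∷ 2F ∷ 4F ∷ []) (p012 ∷ p012 ∷ p021 ∷ p021 ∷ p120 ∷ [])
  ∷ cert (1F ∷ 0F ∷ 3F ∷ 2F ∷ 4F ∷ []) (1F ∷ 0F ∷ 3F ∷ 2F ∷ 4F ∷ []) (p120 ∷ p021 ∷ p012 ∷ p120 ∷ p102 ∷ [])
  ∷ cert (2F ∷ 1F ∷ 3F ∷ 0F ∷ 4F ∷ []) (3F ∷ 1F ∷ 0F ∷ 2F ∷ 4F ∷ []) (p102 ∷ p210 ∷ p201 ∷ p012 ∷ p210 ∷ [])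
  ∷ cert (2F ∷ 0F ∷ 1F ∷ 3F ∷ 4F ∷ []) (1F ∷ 2F ∷ 0F ∷ 3F ∷ 4F ∷ []) (p102 ∷ p102 ∷ p021 ∷ p201 ∷ p201 ∷ [])
  ∷ cert (2F ∷ 0F ∷ 1F ∷ 3F ∷ 4F ∷ []) (1F ∷ 2F ∷ 0F ∷ 3F ∷ 4F ∷ []) (p102 ∷ p120 ∷ p120 ∷ p021 ∷ p021 ∷ [])
  ∷ cert (2F ∷ 1F ∷ 0F ∷ 3F ∷ 4F ∷ []) (2F ∷ 1F ∷ 0F ∷ 3F ∷ 4F ∷ []) (p102 ∷ p021 ∷ p021 ∷ p021 ∷ p120 ∷ [])
  ∷ cert (2F ∷ 1F ∷ 3F ∷ 0F ∷ 4F ∷ []) (3F ∷ 1F ∷ 0F ∷ 2F ∷ 4F ∷ []) (p102 ∷ p021 ∷ p120 ∷ p120 ∷ p210 ∷ [])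
  ∷ cert (3F ∷ 4F ∷ 0F ∷ 2F ∷ 1F ∷ []) (2F ∷ 4F ∷ 3F ∷ 0F ∷ 1F ∷ []) (p021 ∷ p021 ∷ p012 ∷ p210 ∷ p120 ∷ [])
  ∷ cert (0F ∷ 2F ∷ 1F ∷ 3F ∷ 4F ∷ []) (0F ∷ 2F ∷ 1F ∷ 3F ∷ 4F ∷ []) (p210 ∷ p102 ∷ p021 ∷ p120 ∷ p012 ∷ [])
  ∷ cert (1F ∷ 2F ∷ 0F ∷ 4F ∷ 3F ∷ []) (2F ∷ 0F ∷ 1F ∷ 4F ∷ 3F ∷ []) (p120 ∷ p102 ∷ p012 ∷ p102 ∷ p021 ∷ [])
  ∷ cert (1F ∷ 2F ∷ 0F ∷ 3F ∷ 4F ∷ []) (2F ∷ 0F ∷ 1F ∷ 3F ∷ 4F ∷ []) (p120 ∷ p102 ∷ p021 ∷ p120 ∷ p012 ∷ [])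
  ∷ cert (2F ∷ 0F ∷ 1F ∷ 3F ∷ 4F ∷ []) (1F ∷ 2F ∷ 0F ∷ 3F ∷ 4F ∷ []) (p012 ∷ p201 ∷ p012 ∷ p102 ∷ p021 ∷ [])
  ∷ cert (3F ∷ 4F ∷ 0F ∷ 1F ∷ 2F ∷ []) (2F ∷ 3F ∷ 4F ∷ 0F ∷ 1F ∷ []) (p120 ∷ p120 ∷ p201 ∷ p120 ∷ p021 ∷ [])
  ∷ cert (1F ∷ 2F ∷ 0F ∷ 4F ∷ 3F ∷ []) (2F ∷ 0F ∷ 1F ∷ 4F ∷ 3F ∷ []) (p021 ∷ p012 ∷ p210 ∷ p012 ∷ p201 ∷ [])
  ∷ cert (1F ∷ 2F ∷ 0F ∷ 3F ∷ 4F ∷ []) (2F ∷ 0F ∷ 1F ∷ 3F ∷ 4F ∷ []) (p021 ∷ p012 ∷ p120 ∷ p210 ∷ p102 ∷ [])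
  ∷ cert (2F ∷ 0F ∷ 1F ∷ 3F ∷ 4F ∷ []) (1F ∷ 2F ∷ 0F ∷ 3F ∷ 4F ∷ []) (p102 ∷ p210 ∷ p102 ∷ p201 ∷ p120 ∷ [])
  ∷ cert (2F ∷ 0F ∷ 1F ∷ 3F ∷ 4F ∷ []) (1F ∷ 2F ∷ 0F ∷ 3F ∷ 4F ∷ []) (p102 ∷ p210 ∷ p210 ∷ p012 ∷ p201 ∷ [])
  ∷ cert (3F ∷ 0F ∷ 4F ∷ 2F ∷ 1F ∷ []) (1F ∷ 4F ∷ 3F ∷ 0F ∷ 2F ∷ []) (p120 ∷ p012 ∷ p021 ∷ p120 ∷ p120 ∷ [])
  ∷ cert (1F ∷ 0F ∷ 2F ∷ 3F ∷ 4F ∷ []) (1F ∷ 0F ∷ 2F ∷ 3F ∷ 4F ∷ []) (p021 ∷ p021 ∷ p102 ∷ p210 ∷ p012 ∷ [])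
  ∷ cert (2F ∷ 1F ∷ 0F ∷ 3F ∷ 4F ∷ []) (2F ∷ 1F ∷ 0F ∷ 3F ∷ 4F ∷ []) (p102 ∷ p012 ∷ p201 ∷ p201 ∷ p021 ∷ [])
  ∷ cert (1F ∷ 0F ∷ 2F ∷ 3F ∷ 4F ∷ []) (1F ∷ 0F ∷ 2F ∷ 3F ∷ 4F ∷ []) (p120 ∷ p120 ∷ p012 ∷ p120 ∷ p102 ∷ [])
  ∷ cert (2F ∷ 1F ∷ 0F ∷ 3F ∷ 4F ∷ []) (2F ∷ 1F ∷ 0F ∷ 3F ∷ 4F ∷ []) (p012 ∷ p102 ∷ p210 ∷ p102 ∷ p120 ∷ [])
  ∷ cert (2F ∷ 1F ∷ 0F ∷ 3F ∷ 4F ∷ []) (2F ∷ 1F ∷ 0F ∷ 3F ∷ 4F ∷ []) (p102 ∷ p201 ∷ p201 ∷ p012 ∷ p210 ∷ [])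
  ∷ cert (2F ∷ 0F ∷ 1F ∷ 3F ∷ 4F ∷ []) (1F ∷ 2F ∷ 0F ∷ 3F ∷ 4F ∷ []) (p102 ∷ p012 ∷ p120 ∷ p102 ∷ p210 ∷ [])
  ∷ cert (1F ∷ 0F ∷ 3F ∷ 2F ∷ 4F ∷ []) (1F ∷ 0F ∷ 3F ∷ 2F ∷ 4F ∷ []) (p021 ∷ p021 ∷ p201 ∷ p012 ∷ p021 ∷ [])
  ∷ cert (2F ∷ 1F ∷ 3F ∷ 0F ∷ 4F ∷ []) (3F ∷ 1F ∷ 0F ∷ 2F ∷ 4F ∷ []) (p102 ∷ p012 ∷ p210 ∷ p210 ∷ p012 ∷ [])
  ∷ cert (3F ∷ 0F ∷ 2F ∷ 4F ∷ 1F ∷ []) (1F ∷ 4F ∷ 2F ∷ 0F ∷ 3F ∷ []) (p120 ∷ p012 ∷ p021 ∷ p120 ∷ p210 ∷ [])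
  ∷ cert (1F ∷ 0F ∷ 3F ∷ 2F ∷ 4F ∷ []) (1F ∷ 0F ∷ 3F ∷ 2F ∷ 4F ∷ []) (p120 ∷ p120 ∷ p021 ∷ p102 ∷ p201 ∷ [])
  ∷ cert (2F ∷ 1F ∷ 3F ∷ 0F ∷ 4F ∷ []) (3F ∷ 1F ∷ 0F ∷ 2F ∷ 4F ∷ []) (p012 ∷ p102 ∷ p012 ∷ p201 ∷ p210 ∷ [])
  ∷ cert (2F ∷ 1F ∷ 3F ∷ 0F ∷ 4F ∷ []) (3F ∷ 1F ∷ 0F ∷ 2F ∷ 4F ∷ []) (p102 ∷ p201 ∷ p102 ∷ p210 ∷ p120 ∷ [])
  ∷ cert (2F ∷ 0F ∷ 1F ∷ 3F ∷ 4F ∷ []) (1F ∷ 2F ∷ 0F ∷ 3F ∷ 4F ∷ []) (p102 ∷ p012 ∷ p012 ∷ p021 ∷ p102 ∷ [])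
  ∷ cert (2F ∷ 0F ∷ 1F ∷ 3F ∷ 4F ∷ []) (1F ∷ 2F ∷ 0F ∷ 3F ∷ 4F ∷ []) (p102 ∷ p102 ∷ p102 ∷ p012 ∷ p012 ∷ [])
  ∷ cert (2F ∷ 0F ∷ 1F ∷ 3F ∷ 4F ∷ []) (1F ∷ 2F ∷ 0F ∷ 3F ∷ 4F ∷ []) (p102 ∷ p012 ∷ p201 ∷ p210 ∷ p021 ∷ [])
  ∷ cert (2F ∷ 0F ∷ 1F ∷ 3F ∷ 4F ∷ []) (1F ∷ 2F ∷ 0F ∷ 3F ∷ 4F ∷ []) (p102 ∷ p210 ∷ p102 ∷ p201 ∷ p120 ∷ [])
  ∷ cert (2F ∷ 0F ∷ 1F ∷ 3F ∷ 4F ∷ []) (1F ∷ 2F ∷ 0F ∷ 3F ∷ 4F ∷ []) (p102 ∷ p201 ∷ p201 ∷ p021 ∷ p210 ∷ [])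
  ∷ []


-- Every code of length 1 extends the empty code of length 0, for which covering is vacuous.
classified-1-3 : Classified 1 3 reps-1-3
classified-1-3 C tC 3≤|C| = classifyExtensions-sound 3 reps-1-3 ([] ∷ []) {ds = certs-1-3} refl (here refl) C tC 3≤|C| λ ()

classified-2-4 : Classified 2 4 reps-2-4
classified-2-4 = classified-suc (from-yes (3 ≤? 3)) (from-yes (3 * 3 ≤? 2 * 4 + 2)) classified-1-3
  (classifyExtensions-sound 4 reps-2-4 reps-1-3 {ds = certs-2-4} refl)

classified-3-5 : Classified 3 5 reps-3-5
classified-3-5 = classified-suc (from-yes (3 ≤? 4)) (from-yes (3 * 4 ≤? 2 * 5 + 2)) classified-2-4
  (classifyExtensions-sound 5 reps-3-5 reps-2-4 {ds = certs-3-5} refl)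

classified-3-6 : Classified 3 6 reps-3-6
classified-3-6 = classified-suc (from-yes (3 ≤? 4)) (from-yes (3 * 4 ≤? 2 * 6 + 2)) classified-2-4
  (classifyExtensions-sound 6 reps-3-6 reps-2-4 {ds = certs-3-6} refl)

classified-4-7 : Classified 4 7 reps-4-7
classified-4-7 = classified-suc (from-yes (3 ≤? 5)) (from-yes (3 * 5 ≤? 2 * 7 + 2)) classified-3-5
  (classifyExtensions-sound 7 reps-4-7 reps-3-5 {ds = certs-4-7} refl)

classified-4-8 : Classified 4 8 reps-4-8
classified-4-8 = classified-suc (from-yes (3 ≤? 6)) (from-yes (3 * 6 ≤? 2 * 8 + 2)) classified-3-6
  (classifyExtensions-sound 8 reps-4-8 reps-3-6 {ds = certs-4-8} refl)

classified-5-10 : Classified 5 10 reps-5-10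
classified-5-10 = classified-suc (from-yes (3 ≤? 7)) (from-yes (3 * 7 ≤? 2 * 10 + 2)) classified-4-7
  (classifyExtensions-sound 10 reps-5-10 reps-4-7 {ds = certs-5-10} refl)

no-trifferent-5-11 : Classified 5 11 []
no-trifferent-5-11 = classified-suc (from-yes (3 ≤? 8)) (from-yes (3 * 8 ≤? 2 * 11 + 2)) classified-4-8
  (classifyExtensions-sound 11 [] reps-4-8 {ds = []} refl)

no-trifferent-6-14 : Classified 6 14 []
no-trifferent-6-14 = classified-suc (from-yes (3 ≤? 10)) (from-yes (3 * 10 ≤? 2 * 14 + 2)) classified-5-10
  (classifyExtensions-sound 14 [] reps-5-10 {ds = []} refl)

corollary1 : ((k : ℕ) (C : List (Word (k + 5))) → Trifferent C → length C * 2 ^ k ≤ 10 * 3 ^ k)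
    × ((k : ℕ) (C : List (Word (k + 6))) → Trifferent C → length C * 2 ^ k ≤ 13 * 3 ^ k)
corollary1 = growth (from-yes (2 ≤? 10)) (bounded-if-none-large no-trifferent-5-11)
           , growth (from-yes (2 ≤? 13)) (bounded-if-none-large no-trifferent-6-14)
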